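{- Let $u$ be a vertex with two child branches $B$ and $B'$, where $B$ is a long $p$-chain and $B'$ is a long $p'$-chain. Then $B$ and $B'$ can be resolved together: there is a set of tours that covers all demand of $B\cup B'$ and whose total cost is at most $4/3$ times the reduction in the lower bound $LB$ that results from removing the demand of $B\cup B'$.
   Context: Setting: Capacitated Vehicle Routing on a tree $T$ rooted at the depot $r$, with edge lengths $l(e)\ge 0$; demands are scaled so that the vehicle capacity is $Q=1$. For an edge $e=(u,v)$ ($u$ the parent of $v$), $T_v$ is the subtree rooted at $v$, $d(T_v)$ its total demand, the traffic is $f(e)=\lceil d(T_v)\rceil$, and the lower bound is $LB=\sum_{e}2\,l(e)\,f(e)$. $P[u,v]$ is the tree path from $u$ to $v$ and $l(P[u,v])$ its length. A branch at $u$ is $T_v$ together with its stem $(u,v)$; a $p$-branch is a branch whose stem has traffic $p$. Resolving means covering all the demand by a set of tours whose total cost is at most $4/3$ times the reduction in $LB$ caused by removing that demand. A branch is simplified if only leaves carry demand, every leaf has demand strictly between $0$ and $1$, no non-root vertex has degree two, and none of the following operations applies: Condense (an edge $(u,v)$ with traffic 1 and $v$ not a leaf is replaced, together with $T_v$, by a single edge to a new leaf of demand $d(T_v)$ and length equal to the total length of $(u,v)$ and $T_v$); Unzip (if the traffic of $(u,v)$ equals the sum of traffics of its child edges $(v,w_i)$, delete $v$ and add edges $(u,w_i)$ of length $l(u,v)+l(v,w_i)$); Group (if $u$ has at least four children including three leaf children $v_1,v_2,v_3$ with $1.5<d(v_1)+d(v_2)+d(v_3)<2$, add a new child $u'$ of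 $u$ via a zero-length edge and make $v_1,v_2,v_3$ children of $u'$ with their original edge lengths); Unite (if $u$ has leaf children $v_1,v_2$ with $d(v_1)+d(v_2)\le 1$, replace them by one leaf of demand $d(v_1)+d(v_2)$ joined to $u$ by an edge of length $l(u,v_1)+l(u,v_2)$); Slide (if $e_0=(u,v)$ has child edges $e_1=(v,w_1)$, $e_2=(v,w_2)$ with $f(e_0)=f(e_1)$, delete $e_2$ and add edge $(w_1,w_2)$ of length $l(e_2)$). A 2-chain is a simplified 2-branch with stem $e_2^0=(u,v_2^0)$ such that $v_2^0$ has exactly three children $v_1^0,v_1^1,v_1^2$, all leaves, with total demand in $(1.5,2]$, labeled so that $l(e_1^0)\ge l(e_1^1)\ge l(e_1^2)$, where $e_i^j$ denotes the parent edge of $v_i^j$. For $p\ge 3$, a $p$-chain is a simplified $p$-branch with stem $e_p^0=(u,v_p^0)$ such that $v_p^0$ has exactly three children $v_{p-1}^0,v_{p-1}^1,v_{p-1}^2$, where $e_{p-1}^0$ is the stem of a $(p-1)$-chain and $v_{p-1}^1,v_{p-1}^2$ are leaves with $1<d(v_{p-1}^1)+d(v_{p-1}^2)\le 1.5$ and $l(e_{p-1}^1)\ge l(e_{p-1}^2)$. All 2-chains are long; for $p\ge 3$ a $p$-chain is long if $l(e_{p-1}^2)<l(P[v_p^0,r])$ and $e_{p-1}^0$ is the stem of a long $(p-1)$-chain.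
   Formalization: The demands are rational, and the amounts delivered by the tours are taken in the rationals as well. -}

module Defs where

open import Data.Nat as ℕ using (ℕ; zero; suc)
open import Data.Integer as ℤ using (ℤ; +_)
open import Data.Rational using (ℚ; 0ℚ; 1ℚ; _+_; _*_; _-_; _≤_; _<_; _/_; _≤ᵇ_; ceiling)
open import Data.List using (List; []; _∷_; _++_; length; lookup; foldr; [_])
open import Data.Fin using (Fin; toℕ)
open import Data.Bool using (Bool; true; false; if_then_else_; _∨_)
open import Data.Product using (Σ; _×_; _,_; proj₁; proj₂)
open import Data.Unit using (⊤)
open import Data.Empty using (⊥)
open import Relation.Nullary using (¬_)
open import Relation.Binary.PropositionalEquality using (_≡_; _≢_)

-- A vertex is given by the list of its children, each
-- child together with the length of the edge to it.  Vertices are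
-- addressed by paths (lists of child indices) from the vertex.

data Shape : Set where
  node : List (ℚ × Shape) → Shape

children : Shape → List (ℚ × Shape)
children (node cs) = cs

-- demand (or delivered amount) at every vertex, indexed by paths
Dem : Set
Dem = List ℕ → ℚ

sub : Dem → ℕ → Dem
sub δ k = λ p → δ (k ∷ p)

lenOf : (cs : List (ℚ × Shape)) → Fin (length cs) → ℚ
lenOf cs k = proj₁ (lookup cs k)

shOf : (cs : List (ℚ × Shape)) → Fin (length cs) → Shape
shOf cs k = proj₂ (lookup cs k)

demOf : Dem → (cs : List (ℚ × Shape)) → Fin (length cs) → Dem
demOf δ cs k = sub δ (toℕ k)

mutual
  total : Shape → Dem → ℚ
  total (node cs) δ = δ [] + totalCs 0 cs δ

  totalCs : ℕ → List (ℚ × Shape) → Dem → ℚ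
  totalCs k [] δ = 0ℚ
  totalCs k ((l , s) ∷ cs) δ = total s (sub δ k) + totalCs (suc k) cs δ

traffic : Shape → Dem → ℤ
traffic s δ = ceiling (total s δ)

sumTraffic : ℕ → List (ℚ × Shape) → Dem → ℤ
sumTraffic k [] δ = + 0
sumTraffic k ((l , s) ∷ cs) δ = traffic s (sub δ k) ℤ.+ sumTraffic (suc k) cs δ

ℤtoℚ : ℤ → ℚ
ℤtoℚ z = z / 1

two : ℚ
two = + 2 / 1

mutual
  LB : Shape → Dem → ℚ
  LB (node cs) δ = LBcs 0 cs δ

  LBcs : ℕ → List (ℚ × Shape) → Dem → ℚ
  LBcs k [] δ = 0ℚ
  LBcs k ((l , s) ∷ cs) δ =
    two * l * ℤtoℚ (traffic s (sub δ k)) + LB s (sub δ k) + LBcs (suc k) cs δ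

mutual
  NonNegLen : Shape → Set
  NonNegLen (node cs) = NonNegLenCs cs

  NonNegLenCs : List (ℚ × Shape) → Set
  NonNegLenCs [] = ⊤
  NonNegLenCs ((l , s) ∷ cs) = (0ℚ ≤ l) × NonNegLen s × NonNegLenCs cs

data IsVertex : Shape → List ℕ → Set where
  root  : ∀ {s} → IsVertex s []
  child : ∀ {cs p} (k : Fin (length cs)) →
          IsVertex (shOf cs k) p → IsVertex (node cs) (toℕ k ∷ p)

data At : Shape → List ℕ → Shape → ℚ → Set where
  here  : ∀ {s} → At s [] s 0ℚ
  there : ∀ {cs π s h} (k : Fin (length cs)) →
          At (shOf cs k) π s h →
          At (node cs) (toℕ k ∷ π) s (lenOf cs k + h)

-- Tours (splittable): a tour is given by the amounts δ it delivers at
-- the vertices; it carries at most Q = 1 and its cost is the length of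
-- the closed walk from the root through every edge below which it
-- delivers something, i.e. twice the total length of those edges.

mutual
  cost : Shape → Dem → ℚ
  cost (node cs) δ = costCs 0 cs δ

  costCs : ℕ → List (ℚ × Shape) → Dem → ℚ
  costCs k [] δ = 0ℚ
  costCs k ((l , s) ∷ cs) δ =
    (if total s (sub δ k) ≤ᵇ 0ℚ then 0ℚ else two * l + cost s (sub δ k))
    + costCs (suc k) cs δ

IsTour : Shape → Dem → Set
IsTour S δ = (∀ p → 0ℚ ≤ δ p) × (total S δ ≤ 1ℚ)

AllTours : Shape → List Dem → Set
AllTours S [] = ⊤
AllTours S (δ ∷ ts) = IsTour S δ × AllTours S ts

deliveredAt : List Dem → List ℕ → ℚ
deliveredAt ts p = foldr (λ δ acc → δ p + acc) 0ℚ ts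

totalCost : Shape → List Dem → ℚ
totalCost S ts = foldr (λ δ acc → cost S δ + acc) 0ℚ ts

isPrefix : List ℕ → List ℕ → Bool
isPrefix [] q = true
isPrefix (a ∷ p) [] = false
isPrefix (a ∷ p) (b ∷ q) = if a ℕ.≡ᵇ b then isPrefix p q else false

inBranches : List ℕ → ℕ → ℕ → List ℕ → Bool
inBranches π i j q = isPrefix (π ++ [ i ]) q ∨ isPrefix (π ++ [ j ]) q

restrictTo : List ℕ → ℕ → ℕ → Dem → Dem
restrictTo π i j dem q = if inBranches π i j q then dem q else 0ℚ

removeFrom : List ℕ → ℕ → ℕ → Dem → Dem
removeFrom π i j dem q = if inBranches π i j q then 0ℚ else dem q

-- A branch is given by the subtree s = T_v below
-- its stem and its demand δ; the stem is the edge entering s.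

three/two : ℚ
three/two = + 3 / 2

IsLeafChild : (cs : List (ℚ × Shape)) → Fin (length cs) → Set
IsLeafChild cs k = shOf cs k ≡ node []

leafDem : Dem → (cs : List (ℚ × Shape)) → Fin (length cs) → ℚ
leafDem δ cs k = demOf δ cs k []

Local : List (ℚ × Shape) → Dem → Set
Local cs δ =
  ((cs ≡ []) → (0ℚ < δ []) × (δ [] < 1ℚ)) ×
  ((cs ≢ []) → δ [] ≡ 0ℚ) ×
  -- no (non-root) vertex of degree two
  (length cs ≢ 1) ×
  -- Condense does not apply
  ((traffic (node cs) δ ≡ + 1) → cs ≡ []) ×
  -- Unzip does not apply
  (traffic (node cs) δ ≢ sumTraffic 0 cs δ) ×
  -- Group does not apply
  ¬ ((4 ℕ.≤ length cs) ×
     Σ (Fin (length cs)) λ a → Σ (Fin (length cs)) λ b → Σ (Fin (length cs)) λ c →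
       (a ≢ b) × (a ≢ c) × (b ≢ c) ×
       IsLeafChild cs a × IsLeafChild cs b × IsLeafChild cs c ×
       (three/two < leafDem δ cs a + leafDem δ cs b + leafDem δ cs c) ×
       (leafDem δ cs a + leafDem δ cs b + leafDem δ cs c < two)) ×
  -- Unite does not apply
  ¬ (Σ (Fin (length cs)) λ a → Σ (Fin (length cs)) λ b →
       (a ≢ b) × IsLeafChild cs a × IsLeafChild cs b ×
       (leafDem δ cs a + leafDem δ cs b ≤ 1ℚ)) ×
  -- Slide does not apply
  ¬ (Σ (Fin (length cs)) λ a → Σ (Fin (length cs)) λ b →
       (a ≢ b) × (traffic (node cs) δ ≡ traffic (shOf cs a) (demOf δ cs a)))

mutual
  Simplified : Shape → Dem → Set
  Simplified (node cs) δ = Local cs δ × SimplifiedCs 0 cs δ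

  SimplifiedCs : ℕ → List (ℚ × Shape) → Dem → Set
  SimplifiedCs k [] δ = ⊤
  SimplifiedCs k ((l , s) ∷ cs) δ = Simplified s (sub δ k) × SimplifiedCs (suc k) cs δ

-- Chains.  Chain p s δ : the branch with subtree s = T_{v_p^0} is a
-- p-chain.  The children v_{p-1}^0, v_{p-1}^1, v_{p-1}^2 are the
-- children a, b, c (in some order) of v_p^0.

Chain : ℕ → Shape → Dem → Set
Chain 0 s δ = ⊥
Chain 1 s δ = ⊥
Chain 2 (node cs) δ =
  Simplified (node cs) δ × (traffic (node cs) δ ≡ + 2) × (length cs ≡ 3) ×
  Σ (Fin (length cs)) λ a → Σ (Fin (length cs)) λ b → Σ (Fin (length cs)) λ c →
    (a ≢ b) × (a ≢ c) × (b ≢ c) ×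
    IsLeafChild cs a × IsLeafChild cs b × IsLeafChild cs c ×
    (three/two < leafDem δ cs a + leafDem δ cs b + leafDem δ cs c) ×
    (leafDem δ cs a + leafDem δ cs b + leafDem δ cs c ≤ two) ×
    (lenOf cs b ≤ lenOf cs a) × (lenOf cs c ≤ lenOf cs b)
Chain (suc (suc (suc k))) (node cs) δ =
  Simplified (node cs) δ × (traffic (node cs) δ ≡ + (suc (suc (suc k)))) ×
  (length cs ≡ 3) ×
  Σ (Fin (length cs)) λ a → Σ (Fin (length cs)) λ b → Σ (Fin (length cs)) λ c →
    (a ≢ b) × (a ≢ c) × (b ≢ c) ×
    Chain (suc (suc k)) (shOf cs a) (demOf δ cs a) ×
    IsLeafChild cs b × IsLeafChild cs c ×
    (1ℚ < leafDem δ cs b + leafDem δ cs c) ×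
    (leafDem δ cs b + leafDem δ cs c ≤ three/two) ×
    (lenOf cs c ≤ lenOf cs b)

-- LongChain p h s δ : the branch is a long p-chain, where h is the
-- distance l(P[v_p^0, r]) from v_p^0 to the depot.
LongChain : ℕ → ℚ → Shape → Dem → Set
LongChain 0 h s δ = ⊥
LongChain 1 h s δ = ⊥
LongChain 2 h s δ = Chain 2 s δ
LongChain (suc (suc (suc k))) h (node cs) δ =
  Simplified (node cs) δ × (traffic (node cs) δ ≡ + (suc (suc (suc k)))) ×
  (length cs ≡ 3) ×
  Σ (Fin (length cs)) λ a → Σ (Fin (length cs)) λ b → Σ (Fin (length cs)) λ c →
    (a ≢ b) × (a ≢ c) × (b ≢ c) ×
    LongChain (suc (suc k)) (h + lenOf cs a) (shOf cs a) (demOf δ cs a) ×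
    IsLeafChild cs b × IsLeafChild cs c ×
    (1ℚ < leafDem δ cs b + leafDem δ cs c) ×
    (leafDem δ cs b + leafDem δ cs c ≤ three/two) ×
    (lenOf cs c ≤ lenOf cs b) ×
    (lenOf cs c < h)

four/three : ℚ
four/three = + 4 / 3

-- A long p-chain carries more than p - 1/2 units of demand and is served bottom-up by p - 1
-- full tours plus one residual tour.  In a 2-chain one tour takes the longest leaf and tops it
-- up from the shortest, the residual takes the rest; at each higher level one new full tour
-- serves the two leaves and the residual of the chain below absorbs what is left.  As the long
-- chain condition makes the shorter leaf edge shorter than the depth H of the chain, these
-- tours cost at most 4/3 of the chain's own share of LB plus (2/3)(p - 2) H.  Lifting the tours
-- of both chains to the depot adds 2 (h + l) per tour, while more than p + p' - 1 units of
-- demand disappear below u, so every edge above u loses p + p' - 1 units of traffic; the two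
-- budgets then add up to at most 4/3 of the drop in LB.

module Submission where

open import Defs

open import Algebra.Bundles using (CommutativeMonoid)
open import Data.Bool using (Bool; true; false; if_then_else_; T; _∨_)
open import Data.Empty using (⊥; ⊥-elim)
open import Data.Fin using (Fin; toℕ)
import Data.Fin as Fin
open import Data.Fin.Patterns using (0F; 1F; 2F)
import Data.Fin.Properties as Fin
open import Data.Integer as ℤ using (ℤ; +0; +[1+_]; -[1+_])
import Data.Integer.DivMod as ℤ
import Data.Integer.Properties as ℤ
import Data.Integer.Solver
open import Data.List using (List; []; _∷_; _++_; length; map)
import Data.List.Properties as List
open import Data.List.Relation.Unary.All as All using (All; []; _∷_)
import Data.List.Relation.Unary.All.Properties as All
open import Data.Nat as ℕ using (ℕ; zero; suc)
open import Data.Nat.Coprimality using (Coprime)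
import Data.Nat.Properties as ℕ
open import Data.Product using (Σ; _×_; _,_; proj₁; proj₂)
open import Data.Rational
open import Data.Rational.Properties
open import Data.Rational.Solver using (module +-*-Solver)
import Data.Rational.Unnormalised as ℚᵘ
import Data.Rational.Unnormalised.Properties as ℚᵘ
open import Data.Unit using (tt)
open import Function using (_∘_)
open import Relation.Binary.PropositionalEquality
open import Relation.Nullary using (Dec; yes; no; does)

open import Algebra.Properties.CommutativeMonoid.Sum +-0-commutativeMonoid
  using (sum; sum-cong-≗; sum-replicate-zero)
open import Algebra.Properties.CommutativeSemigroup (CommutativeMonoid.commutativeSemigroup +-0-commutativeMonoid)
  using () renaming (interchange to +-interchange)
open +-*-Solver

ℕtoℚ : ℕ → ℚ
ℕtoℚ zero = 0ℚ
ℕtoℚ (suc n) = 1ℚ + ℕtoℚ n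

ℕtoℚ-+ : ∀ m n → ℕtoℚ (m ℕ.+ n) ≡ ℕtoℚ m + ℕtoℚ n
ℕtoℚ-+ zero n = sym (+-identityˡ (ℕtoℚ n))
ℕtoℚ-+ (suc m) n = trans (cong (λ t → 1ℚ + t) (ℕtoℚ-+ m n)) (sym (+-assoc 1ℚ (ℕtoℚ m) (ℕtoℚ n)))

0≤+ : ∀ {x y} → 0ℚ ≤ x → 0ℚ ≤ y → 0ℚ ≤ x + y
0≤+ = +-mono-≤

0<+ : ∀ {x y} → 0ℚ < x → 0ℚ < y → 0ℚ < x + y
0<+ {x} {y} p q = subst (_< x + y) (+-identityʳ 0ℚ) (+-mono-< p q)

0≤* : ∀ {x y} → 0ℚ ≤ x → 0ℚ ≤ y → 0ℚ ≤ x * y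
0≤* {x} {y} p q = nonNegative⁻¹ (x * y) {{nonNeg*nonNeg⇒nonNeg x {{nonNegative p}} y {{nonNegative q}}}}

0≤-diff : ∀ {x y} → x ≤ y → 0ℚ ≤ y - x
0≤-diff {x} {y} h = subst (_≤ y - x) (+-inverseʳ x) (+-monoˡ-≤ (- x) h)

0<-diff : ∀ {x y} → x < y → 0ℚ < y - x
0<-diff {x} {y} h = subst (_< y - x) (+-inverseʳ x) (+-monoˡ-< (- x) h)

≤-by-slack : ∀ {x y} d → y ≡ x + d → 0ℚ ≤ d → x ≤ y
≤-by-slack {x} {y} d e h = subst (x ≤_) (sym e) (subst (_≤ x + d) (+-identityʳ x) (+-monoʳ-≤ x h))

<-by-slack : ∀ {x y} d → y ≡ x + d → 0ℚ < d → x < y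
<-by-slack {x} {y} d e h = subst (x <_) (sym e) (subst (_< x + d) (+-identityʳ x) (+-monoʳ-< x h))

ℤtoℚ≃ : ∀ z → toℚᵘ (ℤtoℚ z) ℚᵘ.≃ ℚᵘ.mkℚᵘ z 0
ℤtoℚ≃ z = toℚᵘ-fromℚᵘ (ℚᵘ.mkℚᵘ z 0)

ℤtoℚ-+ : ∀ z w → ℤtoℚ (z ℤ.+ w) ≡ ℤtoℚ z + ℤtoℚ w
ℤtoℚ-+ z w = toℚᵘ-injective (ℚᵘ.≃-trans (ℤtoℚ≃ (z ℤ.+ w)) (ℚᵘ.≃-trans sum≃ (ℚᵘ.≃-sym
    (ℚᵘ.≃-trans (toℚᵘ-homo-+ (ℤtoℚ z) (ℤtoℚ w)) (ℚᵘ.+-cong (ℤtoℚ≃ z) (ℤtoℚ≃ w))))))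
  where
  sum≃ : ℚᵘ.mkℚᵘ (z ℤ.+ w) 0 ℚᵘ.≃ ℚᵘ.mkℚᵘ z 0 ℚᵘ.+ ℚᵘ.mkℚᵘ w 0
  sum≃ = ℚᵘ.*≡* (cong (ℤ._* ℤ.+ 1) (sym (cong₂ ℤ._+_ (ℤ.*-identityʳ z) (ℤ.*-identityʳ w))))

ℤtoℚ-ℕ : ∀ n → ℤtoℚ (ℤ.+ n) ≡ ℕtoℚ n
ℤtoℚ-ℕ zero = refl
ℤtoℚ-ℕ (suc n) = trans (ℤtoℚ-+ (ℤ.+ 1) (ℤ.+ n)) (cong (λ t → 1ℚ + t) (ℤtoℚ-ℕ n))

ℤtoℚ-mono-≤ : ∀ {z w} → z ℤ.≤ w → ℤtoℚ z ≤ ℤtoℚ w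
ℤtoℚ-mono-≤ {z} {w} h = toℚᵘ-cancel-≤ (ℚᵘ.≤-respʳ-≃ (ℚᵘ.≃-sym (ℤtoℚ≃ w)) (ℚᵘ.≤-respˡ-≃ (ℚᵘ.≃-sym (ℤtoℚ≃ z))
  (ℚᵘ.*≤* (subst₂ ℤ._≤_ (sym (ℤ.*-identityʳ z)) (sym (ℤ.*-identityʳ w)) h))))

ℤtoℚ-cancel-< : ∀ {z w} → ℤtoℚ z < ℤtoℚ w → z ℤ.< w
ℤtoℚ-cancel-< {z} {w} h with ℚᵘ.<-respʳ-≃ (ℤtoℚ≃ w) (ℚᵘ.<-respˡ-≃ (ℤtoℚ≃ z) (toℚᵘ-mono-< h))
... | ℚᵘ.*<* k = subst₂ ℤ._<_ (ℤ.*-identityʳ z) (ℤ.*-identityʳ w) k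

ℤtoℚ-<+1⇒≤ : ∀ {z w} → ℤtoℚ z < ℤtoℚ w + 1ℚ → ℤtoℚ z ≤ ℤtoℚ w
ℤtoℚ-<+1⇒≤ {z} {w} h = ℤtoℚ-mono-≤ (subst (z ℤ.≤_) (ℤ.pred-suc w)
  (ℤ.i<j⇒i≤pred[j] (subst (z ℤ.<_) (ℤ.+-comm w (ℤ.+ 1)) (ℤtoℚ-cancel-< (subst (ℤtoℚ z <_) (sym (ℤtoℚ-+ w (ℤ.+ 1))) h)))))

-- ceiling (n / (1 + d)) unfolds to - ((- n) div (1 + d)); writing - n = r + q (1 + d) with
-- 0 ≤ r ≤ d gives both bounds.
ceiling-mkℚ : ∀ n d .(c : Coprime ℤ.∣ n ∣ (suc d)) → ceiling (mkℚ n d c) ≡ ℤ.- ((ℤ.- n) ℤ./ ℤ.+ suc d)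
ceiling-mkℚ +0 d c = refl
ceiling-mkℚ +[1+ n ] d c = refl
ceiling-mkℚ -[1+ n ] d c = refl

module _ (n : ℤ) (d : ℕ) where
  private
    D : ℤ
    D = ℤ.+ suc d
    q : ℤ
    q = (ℤ.- n) ℤ./ D
    r : ℕ
    r = (ℤ.- n) ℤ.% D

  ceilingᵘ-≥ : n ℤ.* ℤ.+ 1 ℤ.≤ (ℤ.- q) ℤ.* D
  ceilingᵘ-≥ = begin
      n ℤ.* ℤ.+ 1   ≡⟨ ℤ.*-identityʳ n ⟩
      n             ≡⟨ ℤ.neg-involutive n ⟨
      ℤ.- (ℤ.- n)   ≤⟨ ℤ.neg-mono-≤ (ℤ.[n/d]*d≤n (ℤ.- n) D) ⟩
      ℤ.- (q ℤ.* D) ≡⟨ ℤ.neg-distribˡ-* q D ⟩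
      (ℤ.- q) ℤ.* D ∎
    where open ℤ.≤-Reasoning

  ceilingᵘ-< : (ℤ.- q ℤ.+ ℤ.-1ℤ) ℤ.* D ℤ.< n ℤ.* ℤ.+ 1
  ceilingᵘ-< = begin-strict
      (ℤ.- q ℤ.+ ℤ.-1ℤ) ℤ.* D ≡⟨ Z.solve 2 (λ q D → (Z.:- q Z.:+ Z.con ℤ.-1ℤ) Z.:* D Z.:= Z.:- (q Z.:* D) Z.:- D) refl q D ⟩
      ℤ.- (q ℤ.* D) ℤ.- D     <⟨ ℤ.+-monoʳ-< (ℤ.- (q ℤ.* D)) (ℤ.neg-mono-< (ℤ.+<+ (ℤ.n%d<d (ℤ.- n) D))) ⟩
      ℤ.- (q ℤ.* D) ℤ.- ℤ.+ r ≡⟨ Z.solve 3 (λ q D r → Z.:- (q Z.:* D) Z.:- r Z.:= Z.:- (r Z.:+ q Z.:* D)) refl q D (ℤ.+ r) ⟩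
      ℤ.- (ℤ.+ r ℤ.+ q ℤ.* D) ≡⟨ cong ℤ.-_ (ℤ.a≡a%n+[a/n]*n (ℤ.- n) D) ⟨
      ℤ.- (ℤ.- n)             ≡⟨ ℤ.neg-involutive n ⟩
      n                       ≡⟨ ℤ.*-identityʳ n ⟨
      n ℤ.* ℤ.+ 1             ∎
    where
    open ℤ.≤-Reasoning
    module Z = Data.Integer.Solver.+-*-Solver

ceiling-≥ : ∀ x → x ≤ ℤtoℚ (ceiling x)
ceiling-≥ (mkℚ n d c) rewrite ceiling-mkℚ n d c =
  toℚᵘ-cancel-≤ (ℚᵘ.≤-respʳ-≃ (ℚᵘ.≃-sym (ℤtoℚ≃ (ℤ.- ((ℤ.- n) ℤ./ ℤ.+ suc d)))) (ℚᵘ.*≤* (ceilingᵘ-≥ n d)))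

ceiling-< : ∀ x → ℤtoℚ (ceiling x) < x + 1ℚ
ceiling-< x = subst (_< x + 1ℚ) pred+1 (+-monoˡ-< 1ℚ (below x))
  where
  below : ∀ x → ℤtoℚ (ceiling x ℤ.+ ℤ.-1ℤ) < x
  below (mkℚ n d c) rewrite ceiling-mkℚ n d c =
    toℚᵘ-cancel-< (ℚᵘ.<-respˡ-≃ (ℚᵘ.≃-sym (ℤtoℚ≃ (ℤ.- ((ℤ.- n) ℤ./ ℤ.+ suc d) ℤ.+ ℤ.-1ℤ))) (ℚᵘ.*<* (ceilingᵘ-< n d)))
  pred+1 : ℤtoℚ (ceiling x ℤ.+ ℤ.-1ℤ) + 1ℚ ≡ ℤtoℚ (ceiling x)
  pred+1 = trans (sym (ℤtoℚ-+ (ceiling x ℤ.+ ℤ.-1ℤ) (ℤ.+ 1)))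
    (cong ℤtoℚ (trans (ℤ.+-assoc (ceiling x) ℤ.-1ℤ (ℤ.+ 1)) (ℤ.+-identityʳ (ceiling x))))

ceiling-pos : ∀ x → 0ℚ < x → 1ℚ ≤ ℤtoℚ (ceiling x)
ceiling-pos x h = ℤtoℚ-<+1⇒≤ {ℤ.+ 1} {ceiling x} (+-monoˡ-< 1ℚ (<-≤-trans h (ceiling-≥ x)))

ceiling-gap : ∀ m x y → ℕtoℚ m < x - y → ℤtoℚ (ceiling y) + ℕtoℚ m ≤ ℤtoℚ (ceiling x)
ceiling-gap m x y h = subst (_≤ ℤtoℚ (ceiling x)) shift (ℤtoℚ-<+1⇒≤ {ceiling y ℤ.+ ℤ.+ m} {ceiling x} (begin-strict
    ℤtoℚ (ceiling y ℤ.+ ℤ.+ m) ≡⟨ shift ⟩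
    ℤtoℚ (ceiling y) + ℕtoℚ m <⟨ +-mono-< (ceiling-< y) h ⟩
    y + 1ℚ + (x - y)          ≡⟨ solve 2 (λ x y → y :+ con 1ℚ :+ (x :- y) := x :+ con 1ℚ) refl x y ⟩
    x + 1ℚ                    ≤⟨ +-monoˡ-≤ 1ℚ (ceiling-≥ x) ⟩
    ℤtoℚ (ceiling x) + 1ℚ     ∎))
  where
  open ≤-Reasoning
  shift : ℤtoℚ (ceiling y ℤ.+ ℤ.+ m) ≡ ℤtoℚ (ceiling y) + ℕtoℚ m
  shift = trans (ℤtoℚ-+ (ceiling y) (ℤ.+ m)) (cong (λ t → ℤtoℚ (ceiling y) + t) (ℤtoℚ-ℕ m))

sum-zero : ∀ {n} (g : Fin n → ℚ) → (∀ k → g k ≡ 0ℚ) → sum g ≡ 0ℚ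
sum-zero {n} g z = trans (sum-cong-≗ z) (sum-replicate-zero n)

sum-single : ∀ {n} (g : Fin n → ℚ) k → (∀ j → j ≢ k → g j ≡ 0ℚ) → sum g ≡ g k
sum-single g Fin.zero z =
  trans (cong (g Fin.zero +_) (sum-zero (g ∘ Fin.suc) (λ j → z (Fin.suc j) λ ()))) (+-identityʳ _)
sum-single g (Fin.suc k) z = trans (cong (_+ sum (g ∘ Fin.suc)) (z Fin.zero λ ()))
  (trans (+-identityˡ _) (sum-single (g ∘ Fin.suc) k (λ j j≢k → z (Fin.suc j) (j≢k ∘ Fin.suc-injective))))

sum-pair : ∀ {n} (g : Fin n → ℚ) a b → a ≢ b → (∀ j → j ≢ a → j ≢ b → g j ≡ 0ℚ) → sum g ≡ g a + g b
sum-pair g Fin.zero Fin.zero a≢b z = ⊥-elim (a≢b refl)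
sum-pair g Fin.zero (Fin.suc b) a≢b z =
  cong (g Fin.zero +_) (sum-single (g ∘ Fin.suc) b (λ j j≢b → z (Fin.suc j) (λ ()) (j≢b ∘ Fin.suc-injective)))
sum-pair g (Fin.suc a) Fin.zero a≢b z = trans
  (cong (g Fin.zero +_) (sum-single (g ∘ Fin.suc) a (λ j j≢a → z (Fin.suc j) (j≢a ∘ Fin.suc-injective) (λ ()))))
  (+-comm (g Fin.zero) (g (Fin.suc a)))
sum-pair g (Fin.suc a) (Fin.suc b) a≢b z = trans (cong (_+ sum (g ∘ Fin.suc)) (z Fin.zero (λ ()) (λ ())))
  (trans (+-identityˡ _) (sum-pair (g ∘ Fin.suc) a b (a≢b ∘ cong Fin.suc)
    (λ j j≢a j≢b → z (Fin.suc j) (j≢a ∘ Fin.suc-injective) (j≢b ∘ Fin.suc-injective))))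

sum-triple : ∀ (g : Fin 3 → ℚ) a b c → a ≢ b → a ≢ c → b ≢ c → sum g ≡ g a + g b + g c
sum-triple g 0F 1F 2F _ _ _ = solve 3 (λ x y z → x :+ (y :+ (z :+ con 0ℚ)) := x :+ y :+ z) refl (g 0F) (g 1F) (g 2F)
sum-triple g 0F 2F 1F _ _ _ = solve 3 (λ x y z → x :+ (y :+ (z :+ con 0ℚ)) := x :+ z :+ y) refl (g 0F) (g 1F) (g 2F)
sum-triple g 1F 0F 2F _ _ _ = solve 3 (λ x y z → x :+ (y :+ (z :+ con 0ℚ)) := y :+ x :+ z) refl (g 0F) (g 1F) (g 2F)
sum-triple g 1F 2F 0F _ _ _ = solve 3 (λ x y z → x :+ (y :+ (z :+ con 0ℚ)) := y :+ z :+ x) refl (g 0F) (g 1F) (g 2F)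
sum-triple g 2F 0F 1F _ _ _ = solve 3 (λ x y z → x :+ (y :+ (z :+ con 0ℚ)) := z :+ x :+ y) refl (g 0F) (g 1F) (g 2F)
sum-triple g 2F 1F 0F _ _ _ = solve 3 (λ x y z → x :+ (y :+ (z :+ con 0ℚ)) := z :+ y :+ x) refl (g 0F) (g 1F) (g 2F)
sum-triple g 0F 0F _ a≢b _ _ = ⊥-elim (a≢b refl)
sum-triple g 1F 1F _ a≢b _ _ = ⊥-elim (a≢b refl)
sum-triple g 2F 2F _ a≢b _ _ = ⊥-elim (a≢b refl)
sum-triple g 0F _ 0F _ a≢c _ = ⊥-elim (a≢c refl)
sum-triple g 1F _ 1F _ a≢c _ = ⊥-elim (a≢c refl)
sum-triple g 2F _ 2F _ a≢c _ = ⊥-elim (a≢c refl)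
sum-triple g _ 0F 0F _ _ b≢c = ⊥-elim (b≢c refl)
sum-triple g _ 1F 1F _ _ b≢c = ⊥-elim (b≢c refl)
sum-triple g _ 2F 2F _ _ b≢c = ⊥-elim (b≢c refl)

sum-difference : ∀ {n} (g g' : Fin n → ℚ) → sum g - sum g' ≡ sum (λ k → g k - g' k)
sum-difference {zero} g g' = refl
sum-difference {suc n} g g' = trans
  (solve 4 (λ a b c d → (a :+ c) :- (b :+ d) := (a :- b) :+ (c :- d)) refl
    (g Fin.zero) (g' Fin.zero) (sum (g ∘ Fin.suc)) (sum (g' ∘ Fin.suc)))
  (cong (g Fin.zero - g' Fin.zero +_) (sum-difference (g ∘ Fin.suc) (g' ∘ Fin.suc)))

sum-diff-single : ∀ {n} (g g' : Fin n → ℚ) k → (∀ j → j ≢ k → g j ≡ g' j) →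
                  sum g - sum g' ≡ g k - g' k
sum-diff-single g g' k e = trans (sum-difference g g')
  (sum-single _ k (λ j j≢k → trans (cong (_- g' j) (e j j≢k)) (+-inverseʳ (g' j))))

sum-diff-pair : ∀ {n} (g g' : Fin n → ℚ) a b → a ≢ b → (∀ j → j ≢ a → j ≢ b → g j ≡ g' j) →
                sum g - sum g' ≡ (g a - g' a) + (g b - g' b)
sum-diff-pair g g' a b a≢b e = trans (sum-difference g g')
  (sum-pair _ a b a≢b (λ j j≢a j≢b → trans (cong (_- g' j) (e j j≢a j≢b)) (+-inverseʳ (g' j))))

-- Additive functionals on a tree

edgeCost : ℚ → Shape → Dem → ℚ
edgeCost l s δ = if total s δ ≤ᵇ 0ℚ then 0ℚ else two * l + cost s δ

edgeLB : ℚ → Shape → Dem → ℚ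
edgeLB l s δ = two * l * ℤtoℚ (traffic s δ) + LB s δ

sumChildren : (ℚ → Shape → Dem → ℚ) → List (ℚ × Shape) → Dem → ℚ
sumChildren g cs δ = sum (λ k → g (lenOf cs k) (shOf cs k) (sub δ (toℕ k)))

module _ (g : ℚ → Shape → Dem → ℚ) (F : ℕ → List (ℚ × Shape) → Dem → ℚ)
         (F-∷ : ∀ m l s cs δ → F m ((l , s) ∷ cs) δ ≡ g l s (sub δ m) + F (suc m) cs δ)
         (F-[] : ∀ m δ → F m [] δ ≡ 0ℚ) where

  sumChildren-from : ∀ m cs δ → F m cs δ ≡ sum (λ k → g (lenOf cs k) (shOf cs k) (sub δ (m ℕ.+ toℕ k)))
  sumChildren-from m [] δ = F-[] m δ
  sumChildren-from m ((l , s) ∷ cs) δ = trans (F-∷ m l s cs δ) (cong₂ _+_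
    (cong (λ x → g l s (sub δ x)) (sym (ℕ.+-identityʳ m)))
    (trans (sumChildren-from (suc m) cs δ)
      (sum-cong-≗ (λ k → cong (λ x → g (lenOf cs k) (shOf cs k) (sub δ x)) (sym (ℕ.+-suc m (toℕ k)))))))

total-node : ∀ cs δ → total (node cs) δ ≡ δ [] + sumChildren (λ _ → total) cs δ
total-node cs δ = cong (δ [] +_) (sumChildren-from (λ _ → total) totalCs (λ _ _ _ _ _ → refl) (λ _ _ → refl) 0 cs δ)

cost-node : ∀ cs δ → cost (node cs) δ ≡ sumChildren edgeCost cs δ
cost-node = sumChildren-from edgeCost costCs (λ _ _ _ _ _ → refl) (λ _ _ → refl) 0

LB-node : ∀ cs δ → LB (node cs) δ ≡ sumChildren edgeLB cs δ
LB-node = sumChildren-from edgeLB LBcs (λ _ _ _ _ _ → refl) (λ _ _ → refl) 0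

sub-cong : ∀ {δ δ' : Dem} k → δ ≗ δ' → sub δ k ≗ sub δ' k
sub-cong k e q = e (k ∷ q)

mutual
  total-cong : ∀ s {δ δ'} → δ ≗ δ' → total s δ ≡ total s δ'
  total-cong (node cs) e = cong₂ _+_ (e []) (totalCs-cong 0 cs e)

  totalCs-cong : ∀ k cs {δ δ'} → δ ≗ δ' → totalCs k cs δ ≡ totalCs k cs δ'
  totalCs-cong k [] e = refl
  totalCs-cong k ((l , s) ∷ cs) e = cong₂ _+_ (total-cong s (sub-cong k e)) (totalCs-cong (suc k) cs e)

mutual
  cost-cong : ∀ s {δ δ'} → δ ≗ δ' → cost s δ ≡ cost s δ'
  cost-cong (node cs) e = costCs-cong 0 cs e

  costCs-cong : ∀ k cs {δ δ'} → δ ≗ δ' → costCs k cs δ ≡ costCs k cs δ'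
  costCs-cong k [] e = refl
  costCs-cong k ((l , s) ∷ cs) e = cong₂ _+_ (edgeCost-cong l s (sub-cong k e)) (costCs-cong (suc k) cs e)

  edgeCost-cong : ∀ l s {δ δ'} → δ ≗ δ' → edgeCost l s δ ≡ edgeCost l s δ'
  edgeCost-cong l s e rewrite total-cong s e | cost-cong s e = refl

mutual
  LB-cong : ∀ s {δ δ'} → δ ≗ δ' → LB s δ ≡ LB s δ'
  LB-cong (node cs) e = LBcs-cong 0 cs e

  LBcs-cong : ∀ k cs {δ δ'} → δ ≗ δ' → LBcs k cs δ ≡ LBcs k cs δ'
  LBcs-cong k [] e = refl
  LBcs-cong k ((l , s) ∷ cs) e = cong₂ _+_ (edgeLB-cong l s (sub-cong k e)) (LBcs-cong (suc k) cs e)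

  edgeLB-cong : ∀ l s {δ δ'} → δ ≗ δ' → edgeLB l s δ ≡ edgeLB l s δ'
  edgeLB-cong l s e rewrite total-cong s e | LB-cong s e = refl

Zero : Dem → Set
Zero δ = ∀ q → δ q ≡ 0ℚ

NonNeg : Dem → Set
NonNeg δ = ∀ q → 0ℚ ≤ δ q

mutual
  total-zero : ∀ s {δ} → Zero δ → total s δ ≡ 0ℚ
  total-zero (node cs) {δ} z rewrite z [] | totalCs-zero 0 cs z = refl

  totalCs-zero : ∀ k cs {δ} → Zero δ → totalCs k cs δ ≡ 0ℚ
  totalCs-zero k [] z = refl
  totalCs-zero k ((l , s) ∷ cs) {δ} z
    rewrite total-zero s {sub δ k} (z ∘ (k ∷_)) | totalCs-zero (suc k) cs z = refl

mutual
  LB-zero : ∀ s {δ} → Zero δ → LB s δ ≡ 0ℚ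
  LB-zero (node cs) z = LBcs-zero 0 cs z

  LBcs-zero : ∀ k cs {δ} → Zero δ → LBcs k cs δ ≡ 0ℚ
  LBcs-zero k [] z = refl
  LBcs-zero k ((l , s) ∷ cs) z = cong₂ _+_ (edgeLB-zero l s (z ∘ (k ∷_))) (LBcs-zero (suc k) cs z)

  edgeLB-zero : ∀ l s {δ} → Zero δ → edgeLB l s δ ≡ 0ℚ
  edgeLB-zero l s z rewrite total-zero s z | LB-zero s z = trans (+-identityʳ _) (*-zeroʳ (two * l))

edgeCost-zero : ∀ l s {δ} → total s δ ≡ 0ℚ → edgeCost l s δ ≡ 0ℚ
edgeCost-zero l s e rewrite e = refl

mutual
  total-+ : ∀ s (δ δ' : Dem) → total s (λ q → δ q + δ' q) ≡ total s δ + total s δ'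
  total-+ (node cs) δ δ' = trans (cong (δ [] + δ' [] +_) (totalCs-+ 0 cs δ δ'))
    (+-interchange (δ []) (δ' []) (totalCs 0 cs δ) (totalCs 0 cs δ'))

  totalCs-+ : ∀ k cs (δ δ' : Dem) → totalCs k cs (λ q → δ q + δ' q) ≡ totalCs k cs δ + totalCs k cs δ'
  totalCs-+ k [] δ δ' = refl
  totalCs-+ k ((l , s) ∷ cs) δ δ' = trans (cong₂ _+_ (total-+ s (sub δ k) (sub δ' k)) (totalCs-+ (suc k) cs δ δ'))
    (+-interchange (total s (sub δ k)) (total s (sub δ' k)) (totalCs (suc k) cs δ) (totalCs (suc k) cs δ'))

mutual
  total-neg : ∀ s (δ : Dem) → total s (λ q → - δ q) ≡ - total s δ
  total-neg (node cs) δ = trans (cong (- δ [] +_) (totalCs-neg 0 cs δ)) (sym (neg-distrib-+ (δ []) (totalCs 0 cs δ)))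

  totalCs-neg : ∀ k cs (δ : Dem) → totalCs k cs (λ q → - δ q) ≡ - totalCs k cs δ
  totalCs-neg k [] δ = refl
  totalCs-neg k ((l , s) ∷ cs) δ = trans (cong₂ _+_ (total-neg s (sub δ k)) (totalCs-neg (suc k) cs δ))
    (sym (neg-distrib-+ (total s (sub δ k)) (totalCs (suc k) cs δ)))

total-difference : ∀ s (δ δ' : Dem) → total s (λ q → δ q - δ' q) ≡ total s δ - total s δ'
total-difference s δ δ' = trans (total-+ s δ (λ q → - δ' q)) (cong (total s δ +_) (total-neg s δ'))

0≤two : 0ℚ ≤ two
0≤two = *≤* (ℤ.+≤+ ℕ.z≤n)

mutual
  cost-nonNeg : ∀ s δ → NonNegLen s → 0ℚ ≤ cost s δ
  cost-nonNeg (node cs) δ h = costCs-nonNeg 0 cs δ h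

  costCs-nonNeg : ∀ k cs δ → NonNegLenCs cs → 0ℚ ≤ costCs k cs δ
  costCs-nonNeg k [] δ h = ≤-refl
  costCs-nonNeg k ((l , s) ∷ cs) δ (hl , hs , hcs) = 0≤+ (edgeCost-nonNeg l s (sub δ k) hl hs) (costCs-nonNeg (suc k) cs δ hcs)

  edgeCost-nonNeg : ∀ l s δ → 0ℚ ≤ l → NonNegLen s → 0ℚ ≤ edgeCost l s δ
  edgeCost-nonNeg l s δ hl hs with total s δ ≤ᵇ 0ℚ
  ... | true = ≤-refl
  ... | false = 0≤+ (0≤* 0≤two hl) (cost-nonNeg s δ hs)

edgeCost-≤ : ∀ l s δ → 0ℚ ≤ l → NonNegLen s → edgeCost l s δ ≤ two * l + cost s δ
edgeCost-≤ l s δ hl hs with total s δ ≤ᵇ 0ℚ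
... | true = 0≤+ (0≤* 0≤two hl) (cost-nonNeg s δ hs)
... | false = ≤-refl

NonNegLen-child : ∀ cs → NonNegLenCs cs → (k : Fin (length cs)) → (0ℚ ≤ lenOf cs k) × NonNegLen (shOf cs k)
NonNegLen-child ((l , s) ∷ cs) (hl , hs , _) Fin.zero = hl , hs
NonNegLen-child ((l , s) ∷ cs) (_ , _ , h) (Fin.suc k) = NonNegLen-child cs h k

≡ᵇ-refl : ∀ m → (m ℕ.≡ᵇ m) ≡ true
≡ᵇ-refl zero = refl
≡ᵇ-refl (suc m) = ≡ᵇ-refl m

≢⇒≡ᵇ-false : ∀ {m n} → m ≢ n → (m ℕ.≡ᵇ n) ≡ false
≢⇒≡ᵇ-false {zero} {zero} h = ⊥-elim (h refl)
≢⇒≡ᵇ-false {zero} {suc n} h = refl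
≢⇒≡ᵇ-false {suc m} {zero} h = refl
≢⇒≡ᵇ-false {suc m} {suc n} h = ≢⇒≡ᵇ-false (h ∘ cong suc)

≡ᵇ-true⇒≡ : ∀ {m n} → (m ℕ.≡ᵇ n) ≡ true → m ≡ n
≡ᵇ-true⇒≡ {m} {n} h = ℕ.≡ᵇ⇒≡ m n (subst T (sym h) tt)

toℕ-≢ : ∀ {n} {a b : Fin n} → a ≢ b → toℕ a ≢ toℕ b
toℕ-≢ h = h ∘ Fin.toℕ-injective

lift : List ℕ → Dem → Dem
lift [] τ q = τ q
lift (k ∷ π) τ [] = 0ℚ
lift (k ∷ π) τ (x ∷ q) = if k ℕ.≡ᵇ x then lift π τ q else 0ℚ

lift-nonNeg : ∀ π {τ} → NonNeg τ → NonNeg (lift π τ)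
lift-nonNeg [] h q = h q
lift-nonNeg (k ∷ π) h [] = ≤-refl
lift-nonNeg (k ∷ π) h (x ∷ q) with k ℕ.≡ᵇ x
... | true = lift-nonNeg π h q
... | false = ≤-refl

lift-cong : ∀ π {τ τ'} → τ ≗ τ' → lift π τ ≗ lift π τ'
lift-cong [] e q = e q
lift-cong (k ∷ π) e [] = refl
lift-cong (k ∷ π) e (x ∷ q) with k ℕ.≡ᵇ x
... | true = lift-cong π e q
... | false = refl

lift-+ : ∀ π (τ τ' : Dem) q → lift π (λ r → τ r + τ' r) q ≡ lift π τ q + lift π τ' q
lift-+ [] τ τ' q = refl
lift-+ (k ∷ π) τ τ' [] = refl
lift-+ (k ∷ π) τ τ' (x ∷ q) with k ℕ.≡ᵇ x
... | true = lift-+ π τ τ' q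
... | false = refl

lift-0 : ∀ π q → lift π (λ _ → 0ℚ) q ≡ 0ℚ
lift-0 [] q = refl
lift-0 (k ∷ π) [] = refl
lift-0 (k ∷ π) (x ∷ q) with k ℕ.≡ᵇ x
... | true = lift-0 π q
... | false = refl

lift-++ : ∀ π ρ τ → lift (π ++ ρ) τ ≗ lift π (lift ρ τ)
lift-++ [] ρ τ q = refl
lift-++ (k ∷ π) ρ τ [] = refl
lift-++ (k ∷ π) ρ τ (x ∷ q) with k ℕ.≡ᵇ x
... | true = lift-++ π ρ τ q
... | false = refl

lift-off : ∀ k π τ x → k ≢ x → Zero (sub (lift (k ∷ π) τ) x)
lift-off k π τ x h q rewrite ≢⇒≡ᵇ-false h = refl

lift-on : ∀ k π τ → sub (lift (k ∷ π) τ) k ≗ lift π τ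
lift-on k π τ q rewrite ≡ᵇ-refl k = refl

lift-restrict : ∀ π (δ : Dem) q → lift π (λ r → δ (π ++ r)) q ≡ (if isPrefix π q then δ q else 0ℚ)
lift-restrict [] δ q = refl
lift-restrict (k ∷ π) δ [] = refl
lift-restrict (k ∷ π) δ (x ∷ q) with k ℕ.≡ᵇ x in e
... | true with refl ← ≡ᵇ-true⇒≡ {k} {x} e = lift-restrict π (λ r → δ (k ∷ r)) q
... | false = refl

deliveredAt-lift : ∀ π ts q → deliveredAt (map (lift π) ts) q ≡ lift π (deliveredAt ts) q
deliveredAt-lift π [] q = sym (lift-0 π q)
deliveredAt-lift π (τ ∷ ts) q =
  trans (cong (lift π τ q +_) (deliveredAt-lift π ts q)) (sym (lift-+ π τ (deliveredAt ts) q))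

At-NonNegLen : ∀ {S π s h} → At S π s h → NonNegLen S → NonNegLen s
At-NonNegLen here hS = hS
At-NonNegLen {node cs} (there k a) hS = At-NonNegLen a (proj₂ (NonNegLen-child cs hS k))

At-total : ∀ {S π s h} → At S π s h → ∀ τ → total S (lift π τ) ≡ total s τ
At-total here τ = refl
At-total {node cs} (there {π = π} k a) τ = begin
    total (node cs) (lift (toℕ k ∷ π) τ)                   ≡⟨ total-node cs (lift (toℕ k ∷ π) τ) ⟩
    0ℚ + sumChildren (λ _ → total) cs (lift (toℕ k ∷ π) τ) ≡⟨ +-identityˡ _ ⟩
    sumChildren (λ _ → total) cs (lift (toℕ k ∷ π) τ)      ≡⟨ sum-single _ k (λ j j≢k →
      total-zero (shOf cs j) (lift-off (toℕ k) π τ (toℕ j) (toℕ-≢ (j≢k ∘ sym)))) ⟩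
    total (shOf cs k) (sub (lift (toℕ k ∷ π) τ) (toℕ k))   ≡⟨ total-cong (shOf cs k) (lift-on (toℕ k) π τ) ⟩
    total (shOf cs k) (lift π τ)                           ≡⟨ At-total a τ ⟩
    _                                                      ∎
  where open ≡-Reasoning

At-cost : ∀ {S π s h} → At S π s h → NonNegLen S → ∀ τ → cost S (lift π τ) ≤ two * h + cost s τ
At-cost {s = s} here hS τ = ≤-reflexive (sym (trans (cong (_+ cost s τ) (*-zeroʳ two)) (+-identityˡ _)))
At-cost {node cs} (there {π = π} {s = s} {h = h} k a) hS τ with NonNegLen-child cs hS k
... | hl , hs = begin
    cost (node cs) (lift (toℕ k ∷ π) τ)                 ≡⟨ cost-node cs _ ⟩
    sumChildren edgeCost cs (lift (toℕ k ∷ π) τ)        ≡⟨ sum-single _ k (λ j j≢k → edgeCost-zero (lenOf cs j) (shOf cs j)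
      (total-zero (shOf cs j) (lift-off (toℕ k) π τ (toℕ j) (toℕ-≢ (j≢k ∘ sym))))) ⟩
    edgeCost l sk (sub (lift (toℕ k ∷ π) τ) (toℕ k))    ≡⟨ edgeCost-cong l sk (lift-on (toℕ k) π τ) ⟩
    edgeCost l sk (lift π τ)                            ≤⟨ edgeCost-≤ l sk (lift π τ) hl hs ⟩
    two * l + cost sk (lift π τ)                        ≤⟨ +-monoʳ-≤ (two * l) (At-cost a hs τ) ⟩
    two * l + (two * h + cost s τ)
      ≡⟨ solve 3 (λ l h c → con two :* l :+ (con two :* h :+ c) := con two :* (l :+ h) :+ c) refl l h (cost s τ) ⟩
    two * (l + h) + cost s τ                            ∎
  where
  open ≤-Reasoning
  l = lenOf cs k
  sk = shOf cs k

subAt : List ℕ → Dem → Dem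
subAt π δ q = δ (π ++ q)

AgreeOutside : List ℕ → Dem → Dem → Set
AgreeOutside π δ δ' = ∀ q → isPrefix π q ≡ false → δ q ≡ δ' q

module _ {k π δ δ'} (ag : AgreeOutside (k ∷ π) δ δ') where

  agree-root : δ [] ≡ δ' []
  agree-root = ag [] refl

  agree-off : ∀ x → k ≢ x → sub δ x ≗ sub δ' x
  agree-off x k≢x q = ag (x ∷ q) (cong (λ b → if b then isPrefix π q else false) (≢⇒≡ᵇ-false k≢x))

  agree-on : AgreeOutside π (sub δ k) (sub δ' k)
  agree-on q h = ag (k ∷ q) (trans (cong (λ b → if b then isPrefix π q else false) (≡ᵇ-refl k)) h)

total-diff-At : ∀ {S π s h} → At S π s h → (δ δ' : Dem) → AgreeOutside π δ δ' →
                total S δ - total S δ' ≡ total s (subAt π δ) - total s (subAt π δ')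
total-diff-At here δ δ' ag = refl
total-diff-At {node cs} (there {π = π} k a) δ δ' ag = begin
    total (node cs) δ - total (node cs) δ'
      ≡⟨ cong₂ _-_ (total-node cs δ) (total-node cs δ') ⟩
    (δ [] + sumChildren (λ _ → total) cs δ) - (δ' [] + sumChildren (λ _ → total) cs δ')
      ≡⟨ cong (λ t → (δ [] + sumChildren (λ _ → total) cs δ) - (t + sumChildren (λ _ → total) cs δ')) (sym (agree-root ag)) ⟩
    (δ [] + sumChildren (λ _ → total) cs δ) - (δ [] + sumChildren (λ _ → total) cs δ')
      ≡⟨ solve 3 (λ a b c → (a :+ b) :- (a :+ c) := b :- c) refl (δ []) _ _ ⟩
    sumChildren (λ _ → total) cs δ - sumChildren (λ _ → total) cs δ'
      ≡⟨ sum-diff-single _ _ k (λ j j≢k → total-cong (shOf cs j) (agree-off ag (toℕ j) (toℕ-≢ (j≢k ∘ sym)))) ⟩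
    total (shOf cs k) (sub δ (toℕ k)) - total (shOf cs k) (sub δ' (toℕ k))
      ≡⟨ total-diff-At a (sub δ (toℕ k)) (sub δ' (toℕ k)) (agree-on ag) ⟩
    _ ∎
  where open ≡-Reasoning

LB-diff-edge : ∀ {l h m Cd Cr Ld Lr X} → 0ℚ ≤ l → Cr + m ≤ Cd → two * h * m + X ≤ Ld - Lr →
               two * (l + h) * m + X ≤ (two * l * Cd + Ld) - (two * l * Cr + Lr)
LB-diff-edge {l} {h} {m} {Cd} {Cr} {Ld} {Lr} {X} hl gap ih =
  ≤-by-slack _ (solve 8 (λ l h m Cd Cr Ld Lr X → (con two :* l :* Cd :+ Ld) :- (con two :* l :* Cr :+ Lr) :=
      con two :* (l :+ h) :* m :+ X :+ ((con two :* l :* Cd :- con two :* l :* (Cr :+ m)) :+ ((Ld :- Lr) :- (con two :* h :* m :+ X))))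
      refl l h m Cd Cr Ld Lr X)
    (0≤+ (0≤-diff (*-monoˡ-≤-nonNeg (two * l) {{nonNegative (0≤* 0≤two hl)}} gap)) (0≤-diff ih))

-- Every edge on the path to the vertex loses at least m units of traffic.
LB-diff-At : ∀ {S π s h} → At S π s h → NonNegLen S → (δ δ' : Dem) → AgreeOutside π δ δ' → ∀ m →
             ℕtoℚ m < total s (subAt π δ) - total s (subAt π δ') →
             two * h * ℕtoℚ m + (LB s (subAt π δ) - LB s (subAt π δ')) ≤ LB S δ - LB S δ'
LB-diff-At {s = s} here hS δ δ' ag m _ = ≤-reflexive (trans
  (cong (_+ (LB s δ - LB s δ')) (trans (cong (_* ℕtoℚ m) (*-zeroʳ two)) (*-zeroˡ (ℕtoℚ m)))) (+-identityˡ _))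
LB-diff-At {node cs} (there {π = π} k a) hS δ δ' ag m hm with NonNegLen-child cs hS k
... | hl , hs = ≤-trans (LB-diff-edge hl
      (ceiling-gap m (total sk δk) (total sk δk') (subst (ℕtoℚ m <_) (sym (total-diff-At a δk δk' (agree-on ag))) hm))
      (LB-diff-At a hs δk δk' (agree-on ag) m hm)) (≤-reflexive (sym edge))
  where
  sk = shOf cs k
  δk = sub δ (toℕ k)
  δk' = sub δ' (toℕ k)
  edge : LB (node cs) δ - LB (node cs) δ' ≡ edgeLB (lenOf cs k) sk δk - edgeLB (lenOf cs k) sk δk'
  edge = trans (cong₂ _-_ (LB-node cs δ) (LB-node cs δ'))
    (sum-diff-single _ _ k (λ j j≢k → edgeLB-cong (lenOf cs j) (shOf cs j) (agree-off ag (toℕ j) (toℕ-≢ (j≢k ∘ sym)))))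

isPrefix-++ : ∀ π ρ q → isPrefix (π ++ ρ) (π ++ q) ≡ isPrefix ρ q
isPrefix-++ [] ρ q = refl
isPrefix-++ (k ∷ π) ρ q rewrite ≡ᵇ-refl k = isPrefix-++ π ρ q

isPrefix-++⇒isPrefix : ∀ π ρ q → isPrefix (π ++ ρ) q ≡ true → isPrefix π q ≡ true
isPrefix-++⇒isPrefix [] ρ q h = refl
isPrefix-++⇒isPrefix (k ∷ π) ρ (x ∷ q) h with k ℕ.≡ᵇ x
... | true = isPrefix-++⇒isPrefix π ρ q h

¬isPrefix-++ : ∀ π ρ q → isPrefix π q ≡ false → isPrefix (π ++ ρ) q ≡ false
¬isPrefix-++ π ρ q h with isPrefix (π ++ ρ) q in e
... | true = trans (sym (isPrefix-++⇒isPrefix π ρ q e)) h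
... | false = refl

branches-disjoint : ∀ π a b q → isPrefix (π ++ a ∷ []) q ≡ true → isPrefix (π ++ b ∷ []) q ≡ true → a ≡ b
branches-disjoint [] a b (x ∷ q) ha hb with a ℕ.≡ᵇ x in ea | b ℕ.≡ᵇ x in eb
... | true | true = trans (≡ᵇ-true⇒≡ ea) (sym (≡ᵇ-true⇒≡ eb))
branches-disjoint (k ∷ π) a b (x ∷ q) ha hb with k ℕ.≡ᵇ x
... | true = branches-disjoint π a b q ha hb

removeFrom-agree : ∀ π i j δ → AgreeOutside π δ (removeFrom π i j δ)
removeFrom-agree π i j δ q h rewrite ¬isPrefix-++ π (i ∷ []) q h | ¬isPrefix-++ π (j ∷ []) q h = refl

module RemoveTwoChildren (cs : List (ℚ × Shape)) (a b : Fin (length cs)) (a≢b : a ≢ b) {δ δ' : Dem}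
  (same-root : δ [] ≡ δ' []) (off : ∀ k → k ≢ a → k ≢ b → sub δ (toℕ k) ≗ sub δ' (toℕ k))
  (zero-a : Zero (sub δ' (toℕ a))) (zero-b : Zero (sub δ' (toℕ b))) where

  private
    sum-diff : ∀ (g g' : Fin (length cs) → ℚ) → (∀ k → k ≢ a → k ≢ b → g k ≡ g' k) → g' a ≡ 0ℚ → g' b ≡ 0ℚ →
               sum g - sum g' ≡ g a + g b
    sum-diff g g' e ga gb = trans (sum-diff-pair g g' a b a≢b e)
      (cong₂ _+_ (trans (cong (λ t → g a - t) ga) (+-identityʳ (g a))) (trans (cong (λ t → g b - t) gb) (+-identityʳ (g b))))

  total-diff : total (node cs) δ - total (node cs) δ' ≡
               total (shOf cs a) (sub δ (toℕ a)) + total (shOf cs b) (sub δ (toℕ b))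
  total-diff = begin
      total (node cs) δ - total (node cs) δ'
        ≡⟨ cong₂ _-_ (total-node cs δ) (trans (total-node cs δ') (cong (_+ _) (sym same-root))) ⟩
      (δ [] + sumChildren (λ _ → total) cs δ) - (δ [] + sumChildren (λ _ → total) cs δ')
        ≡⟨ solve 3 (λ a b c → (a :+ b) :- (a :+ c) := b :- c) refl (δ []) _ _ ⟩
      sumChildren (λ _ → total) cs δ - sumChildren (λ _ → total) cs δ'
        ≡⟨ sum-diff _ _ (λ k k≢a k≢b → total-cong (shOf cs k) (off k k≢a k≢b))
             (total-zero (shOf cs a) zero-a) (total-zero (shOf cs b) zero-b) ⟩
      _ ∎
    where open ≡-Reasoning

  LB-diff : LB (node cs) δ - LB (node cs) δ' ≡
            edgeLB (lenOf cs a) (shOf cs a) (sub δ (toℕ a)) + edgeLB (lenOf cs b) (shOf cs b) (sub δ (toℕ b))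
  LB-diff = trans (cong₂ _-_ (LB-node cs δ) (LB-node cs δ'))
    (sum-diff _ _ (λ k k≢a k≢b → edgeLB-cong (lenOf cs k) (shOf cs k) (off k k≢a k≢b))
      (edgeLB-zero (lenOf cs a) (shOf cs a) zero-a) (edgeLB-zero (lenOf cs b) (shOf cs b) zero-b))

Simplified-child : ∀ m cs δ → SimplifiedCs m cs δ → (k : Fin (length cs)) →
                   Simplified (shOf cs k) (sub δ (m ℕ.+ toℕ k))
Simplified-child m ((l , s) ∷ cs) δ (h , _) Fin.zero =
  subst (λ x → Simplified s (sub δ x)) (sym (ℕ.+-identityʳ m)) h
Simplified-child m ((l , s) ∷ cs) δ (_ , h) (Fin.suc k) =
  subst (λ x → Simplified (shOf cs k) (sub δ x)) (sym (ℕ.+-suc m (toℕ k))) (Simplified-child (suc m) cs δ h k)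

-- This is the content of Unite not applying.
leaf-pair-exceeds-one : ∀ {cs δ} → Local cs δ → ∀ a b → a ≢ b → IsLeafChild cs a → IsLeafChild cs b →
                        1ℚ < leafDem δ cs a + leafDem δ cs b
leaf-pair-exceeds-one {cs} {δ} (_ , _ , _ , _ , _ , _ , no-unite , _) a b a≢b la lb
  with leafDem δ cs a + leafDem δ cs b ≤? 1ℚ
... | yes le = ⊥-elim (no-unite (a , b , a≢b , la , lb , le))
... | no nle = ≰⇒> nle

module LeafChild (cs : List (ℚ × Shape)) (k : Fin (length cs)) (leaf : IsLeafChild cs k) where

  total≡ : ∀ τ → total (shOf cs k) τ ≡ τ [] + 0ℚ
  total≡ τ rewrite leaf = refl

  cost≡0 : ∀ τ → cost (shOf cs k) τ ≡ 0ℚ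
  cost≡0 τ rewrite leaf = refl

  edgeCost≤ : ∀ τ → 0ℚ ≤ lenOf cs k → edgeCost (lenOf cs k) (shOf cs k) τ ≤ two * lenOf cs k
  edgeCost≤ τ hl = subst (edgeCost (lenOf cs k) (shOf cs k) τ ≤_)
    (trans (cong (two * lenOf cs k +_) (cost≡0 τ)) (+-identityʳ _))
    (edgeCost-≤ (lenOf cs k) (shOf cs k) τ hl (subst NonNegLen (sym leaf) tt))

  edgeLB≥ : ∀ τ → 0ℚ ≤ lenOf cs k → 0ℚ < τ [] → two * lenOf cs k ≤ edgeLB (lenOf cs k) (shOf cs k) τ
  edgeLB≥ τ hl pos = begin
      two * lenOf cs k                                           ≡⟨ *-identityʳ _ ⟨
      two * lenOf cs k * 1ℚ                                      ≤⟨ *-monoˡ-≤-nonNeg (two * lenOf cs k) {{nonNegative (0≤* 0≤two hl)}}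
                                                                      (ceiling-pos _ (subst (0ℚ <_) (sym (trans (total≡ τ) (+-identityʳ _))) pos)) ⟩
      two * lenOf cs k * ℤtoℚ (traffic (shOf cs k) τ)            ≡⟨ +-identityʳ _ ⟨
      two * lenOf cs k * ℤtoℚ (traffic (shOf cs k) τ) + 0ℚ       ≡⟨ cong (two * lenOf cs k * ℤtoℚ (traffic (shOf cs k) τ) +_) LB≡0 ⟨
      edgeLB (lenOf cs k) (shOf cs k) τ                          ∎
    where
    open ≤-Reasoning
    LB≡0 : LB (shOf cs k) τ ≡ 0ℚ
    LB≡0 rewrite leaf = refl

  demand-range : ∀ δ → Simplified (node cs) δ → (0ℚ < leafDem δ cs k) × (leafDem δ cs k < 1ℚ)
  demand-range δ (_ , simp) = proj₁ (proj₁ (subst (λ s → Simplified s (sub δ (toℕ k))) leaf (Simplified-child 0 cs δ simp k))) refl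

module SupportedOnPair (cs : List (ℚ × Shape)) (a b : Fin (length cs)) (a≢b : a ≢ b) (τ : Dem)
  (off : ∀ j → j ≢ a → j ≢ b → total (shOf cs j) (sub τ (toℕ j)) ≡ 0ℚ) where

  total≡ : τ [] ≡ 0ℚ →
           total (node cs) τ ≡ total (shOf cs a) (sub τ (toℕ a)) + total (shOf cs b) (sub τ (toℕ b))
  total≡ τ[]≡0 = trans (total-node cs τ) (trans (cong₂ _+_ τ[]≡0 (sum-pair _ a b a≢b off)) (+-identityˡ _))

  cost≤ : NonNegLenCs cs → cost (node cs) τ ≤
          (two * lenOf cs a + cost (shOf cs a) (sub τ (toℕ a))) + (two * lenOf cs b + cost (shOf cs b) (sub τ (toℕ b)))
  cost≤ hL = begin
      cost (node cs) τ
        ≡⟨ trans (cost-node cs τ) (sum-pair _ a b a≢b (λ j j≢a j≢b → edgeCost-zero (lenOf cs j) (shOf cs j) (off j j≢a j≢b))) ⟩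
      edgeCost (lenOf cs a) (shOf cs a) (sub τ (toℕ a)) + edgeCost (lenOf cs b) (shOf cs b) (sub τ (toℕ b))
        ≤⟨ +-mono-≤ (edge a) (edge b) ⟩
      _ ∎
    where
    open ≤-Reasoning
    edge : ∀ k → edgeCost (lenOf cs k) (shOf cs k) (sub τ (toℕ k)) ≤ two * lenOf cs k + cost (shOf cs k) (sub τ (toℕ k))
    edge k = edgeCost-≤ (lenOf cs k) (shOf cs k) (sub τ (toℕ k)) (proj₁ (NonNegLen-child cs hL k)) (proj₂ (NonNegLen-child cs hL k))

sum-three-children : ∀ (cs : List (ℚ × Shape)) → length cs ≡ 3 → ∀ (g : Fin (length cs) → ℚ) a b c →
                     a ≢ b → a ≢ c → b ≢ c → sum g ≡ g a + g b + g c
sum-three-children (_ ∷ _ ∷ _ ∷ []) refl = sum-triple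

_≟L_ : (p q : List ℕ) → Dec (p ≡ q)
_≟L_ = List.≡-dec ℕ._≟_

point : List ℕ → ℚ → Dem
point r v q = if does (q ≟L r) then v else 0ℚ

point-at : ∀ r v → point r v r ≡ v
point-at r v with r ≟L r
... | yes _ = refl
... | no h = ⊥-elim (h refl)

point-off : ∀ r v q → q ≢ r → point r v q ≡ 0ℚ
point-off r v q h with q ≟L r
... | yes e = ⊥-elim (h e)
... | no _ = refl

point-nonNeg : ∀ r v → 0ℚ ≤ v → NonNeg (point r v)
point-nonNeg r v h q with q ≟L r
... | yes _ = h
... | no _ = ≤-refl

splitTour : ℕ → ℚ → ℕ → Dem
splitTour b x c q = point (b ∷ []) x q + point (c ∷ []) (1ℚ - x) q

module SplitTour {b c : ℕ} (b≢c : b ≢ c) (x : ℚ) where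

  at-b : splitTour b x c (b ∷ []) ≡ x
  at-b = trans (cong₂ _+_ (point-at (b ∷ []) x) (point-off (c ∷ []) (1ℚ - x) (b ∷ []) (b≢c ∘ List.∷-injectiveˡ)))
    (+-identityʳ x)

  at-c : splitTour b x c (c ∷ []) ≡ 1ℚ - x
  at-c = trans (cong₂ _+_ (point-off (b ∷ []) x (c ∷ []) (b≢c ∘ sym ∘ List.∷-injectiveˡ)) (point-at (c ∷ []) (1ℚ - x)))
    (+-identityˡ _)

  off : ∀ q → q ≢ b ∷ [] → q ≢ c ∷ [] → splitTour b x c q ≡ 0ℚ
  off q q≢b q≢c = trans (cong₂ _+_ (point-off (b ∷ []) x q q≢b) (point-off (c ∷ []) (1ℚ - x) q q≢c)) (+-identityˡ 0ℚ)

  amounts-nonNeg : 0ℚ ≤ x → x ≤ 1ℚ → NonNeg (splitTour b x c)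
  amounts-nonNeg 0≤x x≤1 q = 0≤+ (point-nonNeg _ x 0≤x q) (point-nonNeg _ _ (0≤-diff x≤1) q)

module SplitTourAtLeaves (cs : List (ℚ × Shape)) (b c : Fin (length cs)) (b≢c : b ≢ c)
  (leaf-b : IsLeafChild cs b) (leaf-c : IsLeafChild cs c) (x : ℚ) where

  private
    τ = splitTour (toℕ b) x (toℕ c)
    open SplitTour (toℕ-≢ b≢c) x
    zero-off : ∀ j → j ≢ b → j ≢ c → total (shOf cs j) (sub τ (toℕ j)) ≡ 0ℚ
    zero-off j j≢b j≢c = total-zero (shOf cs j) (λ q →
      off (toℕ j ∷ q) (toℕ-≢ j≢b ∘ List.∷-injectiveˡ) (toℕ-≢ j≢c ∘ List.∷-injectiveˡ))
    module Pair = SupportedOnPair cs b c b≢c τ zero-off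

  total≡1 : total (node cs) τ ≡ 1ℚ
  total≡1 = begin
    total (node cs) τ                                 ≡⟨ Pair.total≡ (off [] (λ ()) (λ ())) ⟩
    total (shOf cs b) (sub τ (toℕ b)) + total (shOf cs c) (sub τ (toℕ c))
      ≡⟨ cong₂ _+_ (LeafChild.total≡ cs b leaf-b _) (LeafChild.total≡ cs c leaf-c _) ⟩
    (τ (toℕ b ∷ []) + 0ℚ) + (τ (toℕ c ∷ []) + 0ℚ)     ≡⟨ cong₂ (λ u v → (u + 0ℚ) + (v + 0ℚ)) at-b at-c ⟩
    (x + 0ℚ) + ((1ℚ - x) + 0ℚ)
      ≡⟨ solve 1 (λ x → (x :+ con 0ℚ) :+ ((con 1ℚ :- x) :+ con 0ℚ) := con 1ℚ) refl x ⟩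
    1ℚ                                                ∎
    where open ≡-Reasoning

  cost≤ : NonNegLenCs cs → cost (node cs) τ ≤ two * lenOf cs b + two * lenOf cs c
  cost≤ hL = ≤-trans (Pair.cost≤ hL) (≤-reflexive (cong₂ _+_
    (trans (cong (two * lenOf cs b +_) (LeafChild.cost≡0 cs b leaf-b (sub τ (toℕ b)))) (+-identityʳ (two * lenOf cs b)))
    (trans (cong (two * lenOf cs c +_) (LeafChild.cost≡0 cs c leaf-c (sub τ (toℕ c)))) (+-identityʳ (two * lenOf cs c)))))

module ThreeChildren (cs : List (ℚ × Shape)) (len3 : length cs ≡ 3) (a b c : Fin (length cs))
  (a≢b : a ≢ b) (a≢c : a ≢ c) (b≢c : b ≢ c) where

  private
    sum≡ : ∀ g → sum g ≡ g a + g b + g c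
    sum≡ g = sum-three-children cs len3 g a b c a≢b a≢c b≢c

  total≡ : ∀ τ → total (node cs) τ ≡ τ [] + (total (shOf cs a) (sub τ (toℕ a)) +
             total (shOf cs b) (sub τ (toℕ b)) + total (shOf cs c) (sub τ (toℕ c)))
  total≡ τ = trans (total-node cs τ) (cong (τ [] +_) (sum≡ _))

  cost≡ : ∀ τ → cost (node cs) τ ≡ edgeCost (lenOf cs a) (shOf cs a) (sub τ (toℕ a)) +
            edgeCost (lenOf cs b) (shOf cs b) (sub τ (toℕ b)) + edgeCost (lenOf cs c) (shOf cs c) (sub τ (toℕ c))
  cost≡ τ = trans (cost-node cs τ) (sum≡ _)

  LB≡ : ∀ τ → LB (node cs) τ ≡ edgeLB (lenOf cs a) (shOf cs a) (sub τ (toℕ a)) +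
          edgeLB (lenOf cs b) (shOf cs b) (sub τ (toℕ b)) + edgeLB (lenOf cs c) (shOf cs c) (sub τ (toℕ c))
  LB≡ τ = trans (LB-node cs τ) (sum≡ _)

-- Long chains

half : ℚ
half = ℤ.+ 1 / 2

two/3 : ℚ
two/3 = ℤ.+ 2 / 3

residual : List Dem → Dem → Dem
residual ts δ q = δ q - deliveredAt ts q

FullTour : Shape → Dem → Set
FullTour s τ = NonNeg τ × (total s τ ≡ 1ℚ)

-- The allowance two/3 * (p - 2) * H is what the 4/3 budget leaves over on the path above the
-- chain: together with a partner p'-chain that path loses p + p' - 1 units of traffic and is
-- travelled p + p' times, and 4/3 * 2 (p + p' - 1) - 2 (p + p') = two/3 * ((p - 2) + (p' - 2)).
record ChainTours (p : ℕ) (H : ℚ) (s : Shape) (δ : Dem) : Set where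
  field
    full            : List Dem
    full-length     : suc (length full) ≡ p
    full-tours      : All (FullTour s) full
    residual-nonNeg : NonNeg (residual full δ)
    traffic≡        : ℤtoℚ (traffic s δ) ≡ ℕtoℚ p
    total>          : ℕtoℚ p < total s δ + half
    cost≤           : totalCost s full + cost s (residual full δ) ≤
                      four/three * LB s δ + two/3 * (ℕtoℚ p - two) * H

0≤4/3 : 0ℚ ≤ four/three
0≤4/3 = *≤* (ℤ.+≤+ ℕ.z≤n)

0≤2/3 : 0ℚ ≤ two/3
0≤2/3 = *≤* (ℤ.+≤+ ℕ.z≤n)

chain₂-budget : ∀ {la lb lc A B C H} → lc ≤ lb → lb ≤ la → two * la ≤ A → two * lb ≤ B → two * lc ≤ C →
                ((two * la + two * lc) + 0ℚ) + (0ℚ + two * lb + two * lc) ≤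
                four/three * (A + B + C) + two/3 * (ℕtoℚ 2 - two) * H
chain₂-budget {la} {lb} {lc} {A} {B} {C} {H} lc≤lb lb≤la la≤A lb≤B lc≤C = ≤-by-slack _
  (solve 7 (λ la lb lc A B C H → con four/three :* (A :+ B :+ C) :+ con two/3 :* ((con 1ℚ :+ (con 1ℚ :+ con 0ℚ)) :- con two) :* H :=
     ((con two :* la :+ con two :* lc) :+ con 0ℚ) :+ (con 0ℚ :+ con two :* lb :+ con two :* lc) :+
     (con four/three :* (A :- con two :* la) :+ con four/three :* (B :- con two :* lb) :+ con four/three :* (C :- con two :* lc)
      :+ con two/3 :* (la :- lc) :+ con two/3 :* (lb :- lc))) refl la lb lc A B C H)
  (0≤+ (0≤+ (0≤+ (0≤+ (0≤* 0≤4/3 (0≤-diff la≤A)) (0≤* 0≤4/3 (0≤-diff lb≤B))) (0≤* 0≤4/3 (0≤-diff lc≤C)))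
        (0≤* 0≤2/3 (0≤-diff (≤-trans lc≤lb lb≤la)))) (0≤* 0≤2/3 (0≤-diff lc≤lb)))

chain-step-budget : ∀ {la lb lc H M LBa B C TF Cρ} → 0ℚ ≤ la → lc ≤ lb → lc < H → two * lb ≤ B → two * lc ≤ C →
  TF + Cρ ≤ four/three * LBa + two/3 * ((1ℚ + M) - two) * (H + la) →
  ((two * lb + two * lc) + (M * (two * (la + 0ℚ)) + TF)) + ((two * la + Cρ) + 0ℚ + two * lc) ≤
  four/three * ((two * la * (1ℚ + M) + LBa) + B + C) + two/3 * ((1ℚ + (1ℚ + M)) - two) * H
chain-step-budget {la} {lb} {lc} {H} {M} {LBa} {B} {C} {TF} {Cρ} 0≤la lc≤lb lc<H lb≤B lc≤C ih = ≤-by-slack _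
  (solve 10 (λ la lb lc H M LBa B C TF Cρ →
     con four/three :* ((con two :* la :* (con 1ℚ :+ M) :+ LBa) :+ B :+ C) :+ con two/3 :* ((con 1ℚ :+ (con 1ℚ :+ M)) :- con two) :* H :=
     ((con two :* lb :+ con two :* lc) :+ (M :* (con two :* (la :+ con 0ℚ)) :+ TF)) :+ ((con two :* la :+ Cρ) :+ con 0ℚ :+ con two :* lc) :+
     (con four/three :* (B :- con two :* lb) :+ con four/three :* (C :- con two :* lc)
      :+ ((con four/three :* LBa :+ con two/3 :* ((con 1ℚ :+ M) :- con two) :* (H :+ la)) :- (TF :+ Cρ))
      :+ con two/3 :* (lb :- lc) :+ con two/3 :* (H :- lc) :+ con four/three :* la)) refl la lb lc H M LBa B C TF Cρ)
  (0≤+ (0≤+ (0≤+ (0≤+ (0≤+ (0≤* 0≤4/3 (0≤-diff lb≤B)) (0≤* 0≤4/3 (0≤-diff lc≤C))) (0≤-diff ih))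
        (0≤* 0≤2/3 (0≤-diff lc≤lb))) (0≤* 0≤2/3 (0≤-diff (<⇒≤ lc<H)))) (0≤* 0≤4/3 0≤la))

Local-inner-zero : ∀ {cs δ} → Local cs δ → length cs ≡ 3 → δ [] ≡ 0ℚ
Local-inner-zero {[]} (_ , inner , _) ()
Local-inner-zero {_ ∷ _} (_ , inner , _) _ = inner (λ ())

residual-single : ∀ τ δ q → residual (τ ∷ []) δ q ≡ δ q - τ q
residual-single τ δ q = cong (λ t → δ q - t) (+-identityʳ (τ q))

module TwoChain (H : ℚ) (cs : List (ℚ × Shape)) (δ : Dem) (hL : NonNegLenCs cs) (hδ : NonNeg δ)
  (simp : Simplified (node cs) δ) (len3 : length cs ≡ 3) (a b c : Fin (length cs))
  (a≢b : a ≢ b) (a≢c : a ≢ c) (b≢c : b ≢ c)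
  (leaf-a : IsLeafChild cs a) (leaf-b : IsLeafChild cs b) (leaf-c : IsLeafChild cs c)
  (heavy : three/two < leafDem δ cs a + leafDem δ cs b + leafDem δ cs c)
  (lb≤la : lenOf cs b ≤ lenOf cs a) (lc≤lb : lenOf cs c ≤ lenOf cs b) where

  open ThreeChildren cs len3 a b c a≢b a≢c b≢c
  private
    δa = leafDem δ cs a
    δb = leafDem δ cs b
    δc = leafDem δ cs c
    la = lenOf cs a
    lb = lenOf cs b
    lc = lenOf cs c
    0≤l : ∀ k → 0ℚ ≤ lenOf cs k
    0≤l k = proj₁ (NonNegLen-child cs hL k)
    range-a = LeafChild.demand-range cs a leaf-a δ simp
    module Tour = SplitTour (toℕ-≢ a≢c) δa
    module TL = SplitTourAtLeaves cs a c a≢c leaf-a leaf-c δa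

  -- The full tour takes all of leaf a and tops up from leaf c; leaf b and what is left of c
  -- (positive, since Unite does not apply to a and c) form the residual.
  tour : Dem
  tour = splitTour (toℕ a) δa (toℕ c)

  tour-full : FullTour (node cs) tour
  tour-full = Tour.amounts-nonNeg (<⇒≤ (proj₁ range-a)) (<⇒≤ (proj₂ range-a)) , TL.total≡1

  ρ-at-a : residual (tour ∷ []) δ (toℕ a ∷ []) ≡ 0ℚ
  ρ-at-a = trans (residual-single tour δ _) (trans (cong (λ t → δa - t) Tour.at-b) (+-inverseʳ δa))

  ρ-nonNeg : NonNeg (residual (tour ∷ []) δ)
  ρ-nonNeg q = subst (0ℚ ≤_) (sym (residual-single tour δ q)) (cases q (q ≟L (toℕ a ∷ [])) (q ≟L (toℕ c ∷ [])))
    where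
    cases : ∀ q → Dec (q ≡ toℕ a ∷ []) → Dec (q ≡ toℕ c ∷ []) → 0ℚ ≤ δ q - tour q
    cases q (yes refl) _ = ≤-reflexive (sym (trans (cong (λ t → δa - t) Tour.at-b) (+-inverseʳ δa)))
    cases q (no _) (yes refl) = subst (0ℚ ≤_) (sym (trans (cong (λ t → δc - t) Tour.at-c)
      (solve 2 (λ x y → y :- (con 1ℚ :- x) := (x :+ y) :- con 1ℚ) refl δa δc)))
      (0≤-diff (<⇒≤ (leaf-pair-exceeds-one (proj₁ simp) a c a≢c leaf-a leaf-c)))
    cases q (no q≢a) (no q≢c) =
      subst (0ℚ ≤_) (sym (trans (cong (λ t → δ q - t) (Tour.off q q≢a q≢c)) (+-identityʳ (δ q)))) (hδ q)

  total≡leaves : total (node cs) δ ≡ δa + δb + δc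
  total≡leaves = trans (total≡ δ) (trans (cong₂ _+_ (Local-inner-zero (proj₁ simp) len3)
      (cong₂ _+_ (cong₂ _+_ (LeafChild.total≡ cs a leaf-a _) (LeafChild.total≡ cs b leaf-b _)) (LeafChild.total≡ cs c leaf-c _)))
    (solve 3 (λ x y z → con 0ℚ :+ ((x :+ con 0ℚ) :+ (y :+ con 0ℚ) :+ (z :+ con 0ℚ)) := x :+ y :+ z) refl δa δb δc))

  total> : ℕtoℚ 2 < total (node cs) δ + half
  total> = <-by-slack _ (trans (cong (_+ half) total≡leaves)
      (solve 3 (λ x y z → x :+ y :+ z :+ con half := (con 1ℚ :+ (con 1ℚ :+ con 0ℚ)) :+ ((x :+ y :+ z) :- con three/two)) refl δa δb δc))
    (0<-diff heavy)

  ρ-cost : cost (node cs) (residual (tour ∷ []) δ) ≤ 0ℚ + two * lb + two * lc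
  ρ-cost = begin
      cost (node cs) ρ ≡⟨ cost≡ ρ ⟩
      edgeCost la (shOf cs a) (sub ρ (toℕ a)) + edgeCost lb (shOf cs b) (sub ρ (toℕ b)) + edgeCost lc (shOf cs c) (sub ρ (toℕ c))
        ≤⟨ +-mono-≤ (+-mono-≤ (≤-reflexive (edgeCost-zero la (shOf cs a)
                       (trans (LeafChild.total≡ cs a leaf-a _) (trans (+-identityʳ _) ρ-at-a))))
                     (LeafChild.edgeCost≤ cs b leaf-b _ (0≤l b))) (LeafChild.edgeCost≤ cs c leaf-c _ (0≤l c)) ⟩
      0ℚ + two * lb + two * lc ∎
    where
    open ≤-Reasoning
    ρ = residual (tour ∷ []) δ

  cost≤ : totalCost (node cs) (tour ∷ []) + cost (node cs) (residual (tour ∷ []) δ) ≤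
          four/three * LB (node cs) δ + two/3 * (ℕtoℚ 2 - two) * H
  cost≤ = begin
      (cost (node cs) tour + 0ℚ) + cost (node cs) (residual (tour ∷ []) δ) ≤⟨ +-mono-≤ (+-monoˡ-≤ 0ℚ (TL.cost≤ hL)) ρ-cost ⟩
      ((two * la + two * lc) + 0ℚ) + (0ℚ + two * lb + two * lc)     ≤⟨ chain₂-budget {H = H} lc≤lb lb≤la
          (edgeLB≥ a leaf-a (proj₁ range-a)) (edgeLB≥ b leaf-b (proj₁ (LeafChild.demand-range cs b leaf-b δ simp)))
          (edgeLB≥ c leaf-c (proj₁ (LeafChild.demand-range cs c leaf-c δ simp))) ⟩
      four/three * (eLB a + eLB b + eLB c) + two/3 * (ℕtoℚ 2 - two) * H
        ≡⟨ cong (λ t → four/three * t + two/3 * (ℕtoℚ 2 - two) * H) (LB≡ δ) ⟨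
      four/three * LB (node cs) δ + two/3 * (ℕtoℚ 2 - two) * H       ∎
    where
    open ≤-Reasoning
    eLB : Fin (length cs) → ℚ
    eLB k = edgeLB (lenOf cs k) (shOf cs k) (sub δ (toℕ k))
    edgeLB≥ : ∀ k → IsLeafChild cs k → 0ℚ < leafDem δ cs k → two * lenOf cs k ≤ eLB k
    edgeLB≥ k leaf pos = LeafChild.edgeLB≥ cs k leaf _ (0≤l k) pos

chain₂ : ∀ H cs δ → NonNegLenCs cs → NonNeg δ → Chain 2 (node cs) δ → ChainTours 2 H (node cs) δ
chain₂ H cs δ hL hδ (simp , traffic≡2 , len3 , a , b , c , a≢b , a≢c , b≢c , leaf-a , leaf-b , leaf-c , heavy , _ , lb≤la , lc≤lb) =
  record
    { full = tour ∷ []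
    ; full-length = refl
    ; full-tours = tour-full ∷ []
    ; residual-nonNeg = ρ-nonNeg
    ; traffic≡ = trans (cong ℤtoℚ traffic≡2) (ℤtoℚ-ℕ 2)
    ; total> = total>
    ; cost≤ = cost≤
    }
  where open TwoChain H cs δ hL hδ simp len3 a b c a≢b a≢c b≢c leaf-a leaf-b leaf-c heavy lb≤la lc≤lb

totalCost-map≤ : ∀ S s (f : Dem → Dem) K ts → (∀ τ → cost S (f τ) ≤ K + cost s τ) →
                 totalCost S (map f ts) ≤ ℕtoℚ (length ts) * K + totalCost s ts
totalCost-map≤ S s f K [] h = ≤-reflexive (sym (trans (cong (_+ 0ℚ) (*-zeroˡ K)) (+-identityʳ 0ℚ)))
totalCost-map≤ S s f K (τ ∷ ts) h = ≤-trans (+-mono-≤ (h τ) (totalCost-map≤ S s f K ts h)) (≤-reflexive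
  (solve 4 (λ K c n t → (K :+ c) :+ (n :* K :+ t) := (con 1ℚ :+ n) :* K :+ (c :+ t)) refl K (cost s τ) (ℕtoℚ (length ts)) (totalCost s ts)))

module LongChainStep (k : ℕ) (H : ℚ) (cs : List (ℚ × Shape)) (δ : Dem) (hL : NonNegLenCs cs) (hδ : NonNeg δ)
  (simp : Simplified (node cs) δ) (len3 : length cs ≡ 3) (a b c : Fin (length cs))
  (a≢b : a ≢ b) (a≢c : a ≢ c) (b≢c : b ≢ c)
  (below : ChainTours (suc (suc k)) (H + lenOf cs a) (shOf cs a) (sub δ (toℕ a)))
  (leaf-b : IsLeafChild cs b) (leaf-c : IsLeafChild cs c)
  (b+c>1 : 1ℚ < leafDem δ cs b + leafDem δ cs c)
  (lc≤lb : lenOf cs c ≤ lenOf cs b) (lc<H : lenOf cs c < H) where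

  open ThreeChildren cs len3 a b c a≢b a≢c b≢c
  open ChainTours below using () renaming (full to Fs)
  private
    ta = toℕ a
    δb = leafDem δ cs b
    δc = leafDem δ cs c
    la = lenOf cs a
    lb = lenOf cs b
    lc = lenOf cs c
    sa = shOf cs a
    0≤l : ∀ k → 0ℚ ≤ lenOf cs k
    0≤l k = proj₁ (NonNegLen-child cs hL k)
    range-b = LeafChild.demand-range cs b leaf-b δ simp
    module Tour = SplitTour (toℕ-≢ b≢c) δb
    module TL = SplitTourAtLeaves cs b c b≢c leaf-b leaf-c δb
    up : Dem → Dem
    up = lift (ta ∷ [])
    a-head : ∀ {j} → j ≢ a → ∀ q → ta ∷ q ≢ toℕ j ∷ []
    a-head j≢a q = toℕ-≢ (j≢a ∘ sym) ∘ List.∷-injectiveˡ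

  -- One new full tour serves leaf b and part of leaf c; the full tours of the (p-1)-chain below
  -- are passed on, and its residual joins what is left of leaf c.
  tour : Dem
  tour = splitTour (toℕ b) δb (toℕ c)

  full : List Dem
  full = tour ∷ map up Fs

  full-length : suc (length full) ≡ suc (suc (suc k))
  full-length = cong suc (trans (cong suc (List.length-map up Fs)) (ChainTours.full-length below))

  full-tours : All (FullTour (node cs)) full
  full-tours = (Tour.amounts-nonNeg (<⇒≤ (proj₁ range-b)) (<⇒≤ (proj₂ range-b)) , TL.total≡1)
    ∷ All.map⁺ (All.map (λ { (nonNeg , total≡1) → lift-nonNeg (ta ∷ []) nonNeg ,
                                                   trans (At-total (there {cs = cs} a here) _) total≡1 })
                        (ChainTours.full-tours below))

  ρ≡ : ∀ q → residual full δ q ≡ δ q - (tour q + up (deliveredAt Fs) q)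
  ρ≡ q = cong (λ t → δ q - (tour q + t)) (deliveredAt-lift (ta ∷ []) Fs q)

  ρ-below-a : ∀ q → residual full δ (ta ∷ q) ≡ residual Fs (sub δ ta) q
  ρ-below-a q = trans (ρ≡ (ta ∷ q)) (cong (λ t → δ (ta ∷ q) - t) (trans
    (cong₂ _+_ (Tour.off (ta ∷ q) (a-head (a≢b ∘ sym) q) (a-head (a≢c ∘ sym) q)) (lift-on ta [] (deliveredAt Fs) q))
    (+-identityˡ _)))

  ρ-at-b : residual full δ (toℕ b ∷ []) ≡ 0ℚ
  ρ-at-b = trans (ρ≡ (toℕ b ∷ [])) (trans (cong (λ t → δb - t)
    (trans (cong₂ _+_ Tour.at-b (lift-off ta [] (deliveredAt Fs) (toℕ b) (toℕ-≢ a≢b) [])) (+-identityʳ δb))) (+-inverseʳ δb))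

  ρ-nonNeg : NonNeg (residual full δ)
  ρ-nonNeg q = cases q (q ≟L (toℕ b ∷ [])) (q ≟L (toℕ c ∷ []))
    where
    outside : ∀ q → tour q ≡ 0ℚ → up (deliveredAt Fs) q ≡ 0ℚ → 0ℚ ≤ residual full δ q
    outside q t0 u0 = subst (0ℚ ≤_) (sym (trans (ρ≡ q) (trans (cong₂ (λ u v → δ q - (u + v)) t0 u0)
      (solve 1 (λ x → x :- (con 0ℚ :+ con 0ℚ) := x) refl (δ q))))) (hδ q)
    cases : ∀ q → Dec (q ≡ toℕ b ∷ []) → Dec (q ≡ toℕ c ∷ []) → 0ℚ ≤ residual full δ q
    cases q (yes refl) _ = ≤-reflexive (sym ρ-at-b)
    cases q (no _) (yes refl) = subst (0ℚ ≤_) (sym (trans (ρ≡ (toℕ c ∷ [])) (trans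
      (cong₂ (λ u v → δc - (u + v)) Tour.at-c (lift-off ta [] (deliveredAt Fs) (toℕ c) (toℕ-≢ a≢c) []))
      (solve 2 (λ x y → y :- ((con 1ℚ :- x) :+ con 0ℚ) := (x :+ y) :- con 1ℚ) refl δb δc))))
      (0≤-diff (<⇒≤ b+c>1))
    cases [] (no q≢b) (no q≢c) = outside [] (Tour.off [] q≢b q≢c) refl
    cases (x ∷ q) (no q≢b) (no q≢c) with x ℕ.≟ ta
    ... | yes refl = subst (0ℚ ≤_) (sym (ρ-below-a q)) (ChainTours.residual-nonNeg below q)
    ... | no x≢a = outside (x ∷ q) (Tour.off (x ∷ q) q≢b q≢c) (lift-off ta [] (deliveredAt Fs) x (x≢a ∘ sym) q)

  total> : ℕtoℚ (suc (suc (suc k))) < total (node cs) δ + half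
  total> = <-by-slack _ (begin
      total (node cs) δ + half ≡⟨ cong (_+ half) (total≡ δ) ⟩
      δ [] + (tA + total (shOf cs b) (sub δ (toℕ b)) + total (shOf cs c) (sub δ (toℕ c))) + half
        ≡⟨ cong (_+ half) (cong₂ _+_ (Local-inner-zero (proj₁ simp) len3)
             (cong₂ _+_ (cong (tA +_) (LeafChild.total≡ cs b leaf-b _)) (LeafChild.total≡ cs c leaf-c _))) ⟩
      0ℚ + (tA + (δb + 0ℚ) + (δc + 0ℚ)) + half
        ≡⟨ solve 4 (λ T x y P → con 0ℚ :+ (T :+ (x :+ con 0ℚ) :+ (y :+ con 0ℚ)) :+ con half :=
                                (con 1ℚ :+ P) :+ ((T :+ con half :- P) :+ ((x :+ y) :- con 1ℚ))) refl tA δb δc P ⟩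
      (1ℚ + P) + ((tA + half - P) + ((δb + δc) - 1ℚ)) ∎)
    (0<+ (0<-diff (ChainTours.total> below)) (0<-diff b+c>1))
    where
    open ≡-Reasoning
    tA = total sa (sub δ ta)
    P = ℕtoℚ (suc (suc k))

  ρ-cost : cost (node cs) (residual full δ) ≤ (two * la + cost sa (residual Fs (sub δ ta))) + 0ℚ + two * lc
  ρ-cost = begin
      cost (node cs) ρ ≡⟨ cost≡ ρ ⟩
      edgeCost la sa (sub ρ ta) + edgeCost lb (shOf cs b) (sub ρ (toℕ b)) + edgeCost lc (shOf cs c) (sub ρ (toℕ c))
        ≤⟨ +-mono-≤ (+-mono-≤
             (≤-trans (≤-reflexive (edgeCost-cong la sa ρ-below-a)) (edgeCost-≤ la sa _ (0≤l a) (proj₂ (NonNegLen-child cs hL a))))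
             (≤-reflexive (edgeCost-zero lb (shOf cs b) (trans (LeafChild.total≡ cs b leaf-b _) (trans (+-identityʳ _) ρ-at-b)))))
             (LeafChild.edgeCost≤ cs c leaf-c _ (0≤l c)) ⟩
      (two * la + cost sa (residual Fs (sub δ ta))) + 0ℚ + two * lc ∎
    where
    open ≤-Reasoning
    ρ = residual full δ

  cost≤ : totalCost (node cs) full + cost (node cs) (residual full δ) ≤
          four/three * LB (node cs) δ + two/3 * (ℕtoℚ (suc (suc (suc k))) - two) * H
  cost≤ = begin
      (cost (node cs) tour + totalCost (node cs) (map up Fs)) + cost (node cs) (residual full δ)
        ≤⟨ +-mono-≤ (+-mono-≤ (TL.cost≤ hL) (totalCost-map≤ (node cs) sa up _ Fs (At-cost (there {cs = cs} a here) hL))) ρ-cost ⟩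
      (two * lb + two * lc) + (ℕtoℚ (length Fs) * (two * (la + 0ℚ)) + totalCost sa Fs) + ((two * la + Cρ) + 0ℚ + two * lc)
        ≡⟨ cong (λ n → (two * lb + two * lc) + (ℕtoℚ n * (two * (la + 0ℚ)) + totalCost sa Fs) + ((two * la + Cρ) + 0ℚ + two * lc))
             (ℕ.suc-injective (ChainTours.full-length below)) ⟩
      (two * lb + two * lc) + (ℕtoℚ (suc k) * (two * (la + 0ℚ)) + totalCost sa Fs) + ((two * la + Cρ) + 0ℚ + two * lc)
        ≤⟨ chain-step-budget {M = ℕtoℚ (suc k)} (0≤l a) lc≤lb lc<H (edgeLB≥ b leaf-b) (edgeLB≥ c leaf-c)
             (ChainTours.cost≤ below) ⟩
      four/three * ((two * la * ℕtoℚ (suc (suc k)) + LB sa (sub δ ta)) + eLB b + eLB c) + two/3 * (ℕtoℚ (suc (suc (suc k))) - two) * H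
        ≡⟨ cong (λ t → four/three * (t + eLB b + eLB c) + two/3 * (ℕtoℚ (suc (suc (suc k))) - two) * H)
             (cong (λ t → two * la * t + LB sa (sub δ ta)) (ChainTours.traffic≡ below)) ⟨
      four/three * (eLB a + eLB b + eLB c) + two/3 * (ℕtoℚ (suc (suc (suc k))) - two) * H
        ≡⟨ cong (λ t → four/three * t + two/3 * (ℕtoℚ (suc (suc (suc k))) - two) * H) (LB≡ δ) ⟨
      four/three * LB (node cs) δ + two/3 * (ℕtoℚ (suc (suc (suc k))) - two) * H ∎
    where
    open ≤-Reasoning
    Cρ = cost sa (residual Fs (sub δ ta))
    eLB : Fin (length cs) → ℚ
    eLB j = edgeLB (lenOf cs j) (shOf cs j) (sub δ (toℕ j))
    edgeLB≥ : ∀ j → IsLeafChild cs j → two * lenOf cs j ≤ eLB j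
    edgeLB≥ j leaf = LeafChild.edgeLB≥ cs j leaf _ (0≤l j) (proj₁ (LeafChild.demand-range cs j leaf δ simp))

chain-step : ∀ k H cs δ → NonNegLenCs cs → NonNeg δ → LongChain (suc (suc (suc k))) H (node cs) δ →
             (∀ H' s' δ' → NonNegLen s' → NonNeg δ' → LongChain (suc (suc k)) H' s' δ' → ChainTours (suc (suc k)) H' s' δ') →
             ChainTours (suc (suc (suc k))) H (node cs) δ
chain-step k H cs δ hL hδ
  (simp , traffic≡p , len3 , a , b , c , a≢b , a≢c , b≢c , chain-a , leaf-b , leaf-c , b+c>1 , _ , lc≤lb , lc<H) IH =
  record
    { full = full
    ; full-length = full-length
    ; full-tours = full-tours
    ; residual-nonNeg = ρ-nonNeg
    ; traffic≡ = trans (cong ℤtoℚ traffic≡p) (ℤtoℚ-ℕ (suc (suc (suc k))))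
    ; total> = total>
    ; cost≤ = cost≤
    }
  where
  below = IH (H + lenOf cs a) (shOf cs a) (sub δ (toℕ a)) (proj₂ (NonNegLen-child cs hL a)) (hδ ∘ (toℕ a ∷_)) chain-a
  open LongChainStep k H cs δ hL hδ simp len3 a b c a≢b a≢c b≢c below leaf-b leaf-c b+c>1 lc≤lb lc<H

long-chain : ∀ p H s δ → NonNegLen s → NonNeg δ → LongChain p H s δ → ChainTours p H s δ
long-chain 2 H (node cs) δ hL hδ chain = chain₂ H cs δ hL hδ chain
long-chain (suc (suc (suc k))) H (node cs) δ hL hδ chain = chain-step k H cs δ hL hδ chain (long-chain (suc (suc k)))

-- Lifting the tours of a branch to the whole tree

deliveredAt-++ : ∀ xs ys q → deliveredAt (xs ++ ys) q ≡ deliveredAt xs q + deliveredAt ys q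
deliveredAt-++ [] ys q = sym (+-identityˡ _)
deliveredAt-++ (x ∷ xs) ys q = trans (cong (x q +_) (deliveredAt-++ xs ys q)) (sym (+-assoc (x q) _ _))

totalCost-++ : ∀ S xs ys → totalCost S (xs ++ ys) ≡ totalCost S xs + totalCost S ys
totalCost-++ S [] ys = sym (+-identityˡ _)
totalCost-++ S (x ∷ xs) ys = trans (cong (cost S x +_) (totalCost-++ S xs ys)) (sym (+-assoc (cost S x) _ _))

All⇒AllTours : ∀ S ts → All (IsTour S) ts → AllTours S ts
All⇒AllTours S [] [] = tt
All⇒AllTours S (t ∷ ts) (p ∷ ps) = p , All⇒AllTours S ts ps

total-deliveredAt : ∀ s ts → All (FullTour s) ts → total s (deliveredAt ts) ≡ ℕtoℚ (length ts)
total-deliveredAt s [] [] = total-zero s (λ q → refl)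
total-deliveredAt s (τ ∷ ts) ((_ , total≡1) ∷ ps) =
  trans (total-+ s τ (deliveredAt ts)) (cong₂ _+_ total≡1 (total-deliveredAt s ts ps))

module BranchAt (S : Shape) (hS : NonNegLen S) (π : List ℕ) (cs : List (ℚ × Shape)) (h : ℚ)
  (at : At S π (node cs) h) (i : Fin (length cs)) (dem : Dem) {p : ℕ}
  (chain : ChainTours p (h + lenOf cs i) (shOf cs i) (λ q → dem (π ++ (toℕ i ∷ q)))) where

  open ChainTours chain
  private
    ti = toℕ i
    si = shOf cs i
    li = lenOf cs i
    δi : Dem
    δi q = dem (π ++ (ti ∷ q))
    path = π ++ ti ∷ []

  0≤stem : 0ℚ ≤ lenOf cs i
  0≤stem = proj₁ (NonNegLen-child cs (At-NonNegLen at hS) i)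

  tours : List Dem
  tours = map (lift path) (residual full δi ∷ full)

  size : ℕtoℚ p ≡ 1ℚ + ℕtoℚ (length full)
  size = cong ℕtoℚ (sym full-length)

  lift-total : ∀ τ → total S (lift path τ) ≡ total si τ
  lift-total τ = trans (total-cong S (lift-++ π (ti ∷ []) τ))
    (trans (At-total at (lift (ti ∷ []) τ)) (At-total (there {cs = cs} i here) τ))

  lift-cost : ∀ τ → cost S (lift path τ) ≤ (two * h + two * (li + 0ℚ)) + cost si τ
  lift-cost τ = begin
      cost S (lift path τ)                          ≡⟨ cost-cong S (lift-++ π (ti ∷ []) τ) ⟩
      cost S (lift π (lift (ti ∷ []) τ))            ≤⟨ At-cost at hS _ ⟩
      two * h + cost (node cs) (lift (ti ∷ []) τ)   ≤⟨ +-monoʳ-≤ (two * h) (At-cost (there {cs = cs} i here) (At-NonNegLen at hS) τ) ⟩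
      two * h + (two * (li + 0ℚ) + cost si τ)       ≡⟨ +-assoc (two * h) _ _ ⟨
      (two * h + two * (li + 0ℚ)) + cost si τ       ∎
    where open ≤-Reasoning

  residual-total≤1 : total si (residual full δi) ≤ 1ℚ
  residual-total≤1 = begin
      total si (residual full δi)                  ≡⟨ total-difference si δi (deliveredAt full) ⟩
      total si δi - total si (deliveredAt full)    ≡⟨ cong (λ t → total si δi - t) (total-deliveredAt si full full-tours) ⟩
      total si δi - ℕtoℚ (length full)
        ≤⟨ +-monoˡ-≤ (- ℕtoℚ (length full)) (≤-trans (ceiling-≥ (total si δi)) (≤-reflexive (trans traffic≡ size))) ⟩
      (1ℚ + ℕtoℚ (length full)) - ℕtoℚ (length full)
        ≡⟨ solve 1 (λ x → (con 1ℚ :+ x) :- x := con 1ℚ) refl (ℕtoℚ (length full)) ⟩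
      1ℚ                                           ∎
    where open ≤-Reasoning

  tours-valid : All (IsTour S) tours
  tours-valid = All.map⁺ ((lift-nonNeg path residual-nonNeg , subst (_≤ 1ℚ) (sym (lift-total _)) residual-total≤1)
    ∷ All.map (λ { (nonNeg , total≡1) → lift-nonNeg path nonNeg , ≤-reflexive (trans (lift-total _) total≡1) }) full-tours)

  delivered : ∀ q → deliveredAt tours q ≡ (if isPrefix path q then dem q else 0ℚ)
  delivered q = begin
      deliveredAt tours q                               ≡⟨ deliveredAt-lift path (residual full δi ∷ full) q ⟩
      lift path (deliveredAt (residual full δi ∷ full)) q ≡⟨ lift-cong path (λ r →
        solve 2 (λ x y → (x :- y) :+ y := x) refl (δi r) (deliveredAt full r)) q ⟩
      lift path δi q                                    ≡⟨ lift-cong path (λ r → cong dem (sym (List.++-assoc π (ti ∷ []) r))) q ⟩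
      lift path (λ r → dem (path ++ r)) q               ≡⟨ lift-restrict path dem q ⟩
      (if isPrefix path q then dem q else 0ℚ)           ∎
    where open ≡-Reasoning

  tours-cost : totalCost S tours ≤ (1ℚ + ℕtoℚ (length full)) * (two * h + two * (li + 0ℚ)) +
                                   (totalCost si full + cost si (residual full δi))
  tours-cost = ≤-trans (totalCost-map≤ S si (lift path) K (residual full δi ∷ full) lift-cost)
    (≤-reflexive (cong ((1ℚ + ℕtoℚ (length full)) * K +_) (+-comm (cost si (residual full δi)) (totalCost si full))))
    where K = two * h + two * (li + 0ℚ)

  cost-budget : totalCost si full + cost si (residual full δi) ≤
                four/three * LB si δi + two/3 * ((1ℚ + ℕtoℚ (length full)) - two) * (h + li)
  cost-budget = subst (λ t → _ ≤ four/three * LB si δi + two/3 * (t - two) * (h + li)) size cost≤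

resolve-budget : ∀ {h li lj n n' Li Lj Ci Cj} → 0ℚ ≤ li → 0ℚ ≤ lj →
  Ci ≤ four/three * Li + two/3 * ((1ℚ + n) - two) * (h + li) →
  Cj ≤ four/three * Lj + two/3 * ((1ℚ + n') - two) * (h + lj) →
  ((1ℚ + n) * (two * h + two * (li + 0ℚ)) + Ci) + ((1ℚ + n') * (two * h + two * (lj + 0ℚ)) + Cj) ≤
  four/three * (two * h * (n + (1ℚ + n')) + ((two * li * (1ℚ + n) + Li) + (two * lj * (1ℚ + n') + Lj)))
resolve-budget {h} {li} {lj} {n} {n'} {Li} {Lj} {Ci} {Cj} 0≤li 0≤lj budget-i budget-j = ≤-by-slack _
  (solve 9 (λ h li lj n n' Li Lj Ci Cj →
     con four/three :* (con two :* h :* (n :+ (con 1ℚ :+ n')) :+ ((con two :* li :* (con 1ℚ :+ n) :+ Li) :+ (con two :* lj :* (con 1ℚ :+ n') :+ Lj))) :=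
     ((con 1ℚ :+ n) :* (con two :* h :+ con two :* (li :+ con 0ℚ)) :+ Ci) :+ ((con 1ℚ :+ n') :* (con two :* h :+ con two :* (lj :+ con 0ℚ)) :+ Cj) :+
     ((((con four/three :* Li :+ con two/3 :* ((con 1ℚ :+ n) :- con two) :* (h :+ li)) :- Ci) :+
       ((con four/three :* Lj :+ con two/3 :* ((con 1ℚ :+ n') :- con two) :* (h :+ lj)) :- Cj))
      :+ con four/three :* li :+ con four/three :* lj)) refl h li lj n n' Li Lj Ci Cj)
  (0≤+ (0≤+ (0≤+ (0≤-diff budget-i) (0≤-diff budget-j)) (0≤* 0≤4/3 0≤li)) (0≤* 0≤4/3 0≤lj))

Resolves : Shape → Dem → List ℕ → ℕ → ℕ → List Dem → Set
Resolves S dem π i j tours =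
  AllTours S tours ×
  (∀ q → IsVertex S q → deliveredAt tours q ≡ restrictTo π i j dem q) ×
  (totalCost S tours ≤ four/three * (LB S dem - LB S (removeFrom π i j dem)))

restrict-disjoint : ∀ (A B : Bool) x → (A ≡ true → B ≡ true → ⊥) →
                    (if A then x else 0ℚ) + (if B then x else 0ℚ) ≡ (if A ∨ B then x else 0ℚ)
restrict-disjoint true true x h = ⊥-elim (h refl refl)
restrict-disjoint true false x h = +-identityʳ x
restrict-disjoint false true x h = +-identityˡ x
restrict-disjoint false false x h = +-identityˡ 0ℚ

module PairAt (S : Shape) (dem : Dem) (hS : NonNegLen S) (π : List ℕ) (cs : List (ℚ × Shape)) (h : ℚ)
  (at : At S π (node cs) h) (i j : Fin (length cs)) (i≢j : i ≢ j) {p p' : ℕ}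
  (chain-i : ChainTours p (h + lenOf cs i) (shOf cs i) (λ q → dem (π ++ (toℕ i ∷ q))))
  (chain-j : ChainTours p' (h + lenOf cs j) (shOf cs j) (λ q → dem (π ++ (toℕ j ∷ q)))) where

  module Bi = BranchAt S hS π cs h at i dem chain-i
  module Bj = BranchAt S hS π cs h at j dem chain-j
  private
    ti = toℕ i
    tj = toℕ j
    rem = removeFrom π ti tj dem
    n = ℕtoℚ (length (ChainTours.full chain-i))
    n' = ℕtoℚ (length (ChainTours.full chain-j))
    m = length (ChainTours.full chain-i) ℕ.+ p'

  tours : List Dem
  tours = Bi.tours ++ Bj.tours

  valid : AllTours S tours
  valid = All⇒AllTours S tours (All.++⁺ Bi.tours-valid Bj.tours-valid)

  delivered : ∀ q → deliveredAt tours q ≡ restrictTo π ti tj dem q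
  delivered q = trans (deliveredAt-++ Bi.tours Bj.tours q) (trans (cong₂ _+_ (Bi.delivered q) (Bj.delivered q))
    (restrict-disjoint _ _ (dem q) (λ in-i in-j → toℕ-≢ i≢j (branches-disjoint π ti tj q in-i in-j))))

  private
    same-root : subAt π dem [] ≡ subAt π rem []
    same-root rewrite isPrefix-++ π (ti ∷ []) [] | isPrefix-++ π (tj ∷ []) [] = refl

    same-off : ∀ k → k ≢ i → k ≢ j → sub (subAt π dem) (toℕ k) ≗ sub (subAt π rem) (toℕ k)
    same-off k k≢i k≢j q rewrite isPrefix-++ π (ti ∷ []) (toℕ k ∷ q) | isPrefix-++ π (tj ∷ []) (toℕ k ∷ q)
      | ≢⇒≡ᵇ-false (toℕ-≢ (k≢i ∘ sym)) | ≢⇒≡ᵇ-false (toℕ-≢ (k≢j ∘ sym)) = refl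

    removed-i : Zero (sub (subAt π rem) ti)
    removed-i q rewrite isPrefix-++ π (ti ∷ []) (ti ∷ q) | ≡ᵇ-refl ti = refl

    removed-j : Zero (sub (subAt π rem) tj)
    removed-j q rewrite isPrefix-++ π (ti ∷ []) (tj ∷ q) | isPrefix-++ π (tj ∷ []) (tj ∷ q)
      | ≢⇒≡ᵇ-false (toℕ-≢ i≢j) | ≡ᵇ-refl tj = refl

  module Removed = RemoveTwoChildren cs i j i≢j {subAt π dem} {subAt π rem} same-root same-off removed-i removed-j

  private
    D = subAt π dem
    D' = subAt π rem
    Ti = total (shOf cs i) (sub D ti)
    Tj = total (shOf cs j) (sub D tj)

  removed-demand : ℕtoℚ m < total (node cs) D - total (node cs) D'
  removed-demand = subst (ℕtoℚ m <_) (sym Removed.total-diff)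
    (<-by-slack _ split (0<+ (0<-diff (ChainTours.total> chain-i)) (0<-diff (ChainTours.total> chain-j))))
    where
    open ≡-Reasoning
    split : Ti + Tj ≡ ℕtoℚ m + (((Ti + half) - ℕtoℚ p) + ((Tj + half) - ℕtoℚ p'))
    split = begin
      Ti + Tj ≡⟨ solve 4 (λ x y a b → x :+ y := (a :+ b) :+ (((x :+ con half) :- (con 1ℚ :+ a)) :+ ((y :+ con half) :- b)))
                   refl Ti Tj n (ℕtoℚ p') ⟩
      (n + ℕtoℚ p') + (((Ti + half) - (1ℚ + n)) + ((Tj + half) - ℕtoℚ p'))
        ≡⟨ cong₂ (λ u v → u + (((Ti + half) - v) + ((Tj + half) - ℕtoℚ p')))
             (sym (ℕtoℚ-+ (length (ChainTours.full chain-i)) p')) (sym Bi.size) ⟩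
      ℕtoℚ m + (((Ti + half) - ℕtoℚ p) + ((Tj + half) - ℕtoℚ p')) ∎

  LB-drop : two * h * ℕtoℚ m + (LB (node cs) D - LB (node cs) D') ≤ LB S dem - LB S rem
  LB-drop = LB-diff-At at hS dem rem (removeFrom-agree π ti tj dem) m removed-demand

  LB-drop≡ : two * h * ℕtoℚ m + (LB (node cs) D - LB (node cs) D') ≡
             two * h * (n + (1ℚ + n')) + ((two * lenOf cs i * (1ℚ + n) + LB (shOf cs i) (sub D ti)) +
                                          (two * lenOf cs j * (1ℚ + n') + LB (shOf cs j) (sub D tj)))
  LB-drop≡ = cong₂ (λ u v → two * h * u + v) (trans (ℕtoℚ-+ (length (ChainTours.full chain-i)) p') (cong (n +_) Bj.size))
    (trans Removed.LB-diff (cong₂ _+_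
      (cong (λ t → two * lenOf cs i * t + LB (shOf cs i) (sub D ti)) (trans (ChainTours.traffic≡ chain-i) Bi.size))
      (cong (λ t → two * lenOf cs j * t + LB (shOf cs j) (sub D tj)) (trans (ChainTours.traffic≡ chain-j) Bj.size))))

  cost-bound : totalCost S tours ≤ four/three * (LB S dem - LB S rem)
  cost-bound = begin
      totalCost S tours                                ≡⟨ totalCost-++ S Bi.tours Bj.tours ⟩
      totalCost S Bi.tours + totalCost S Bj.tours      ≤⟨ +-mono-≤ Bi.tours-cost Bj.tours-cost ⟩
      _                                                ≤⟨ resolve-budget {h = h} {n = n} {n' = n'}
                                                            Bi.0≤stem Bj.0≤stem Bi.cost-budget Bj.cost-budget ⟩
      four/three * (two * h * (n + (1ℚ + n')) + ((two * lenOf cs i * (1ℚ + n) + LB (shOf cs i) (sub D ti)) +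
                                                 (two * lenOf cs j * (1ℚ + n') + LB (shOf cs j) (sub D tj))))
                                                       ≡⟨ cong (four/three *_) LB-drop≡ ⟨
      four/three * (two * h * ℕtoℚ m + (LB (node cs) D - LB (node cs) D'))
        ≤⟨ *-monoˡ-≤-nonNeg four/three {{nonNegative 0≤4/3}} LB-drop ⟩
      four/three * (LB S dem - LB S rem)               ∎
    where open ≤-Reasoning

resolve-pair : (S : Shape) (dem : Dem) → NonNegLen S → (π : List ℕ) (cs : List (ℚ × Shape)) (h : ℚ) →
  At S π (node cs) h → (i j : Fin (length cs)) → i ≢ j → {p p' : ℕ} →
  ChainTours p (h + lenOf cs i) (shOf cs i) (λ q → dem (π ++ (toℕ i ∷ q))) →
  ChainTours p' (h + lenOf cs j) (shOf cs j) (λ q → dem (π ++ (toℕ j ∷ q))) →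
  Σ (List Dem) (Resolves S dem π (toℕ i) (toℕ j))
resolve-pair S dem hS π cs h at i j i≢j chain-i chain-j = tours , valid , (λ q _ → delivered q) , cost-bound
  where open PairAt S dem hS π cs h at i j i≢j chain-i chain-j

lemma5 : (S : Shape) (dem : Dem) → NonNegLen S → (∀ q → 0ℚ ≤ dem q) →
    (π : List ℕ) (cs : List (ℚ × Shape)) (h : ℚ) → At S π (node cs) h →
    (i j : Fin (length cs)) → i ≢ j → (p p' : ℕ) →
    LongChain p (h + lenOf cs i) (shOf cs i) (λ q → dem (π ++ (toℕ i ∷ q))) →
    LongChain p' (h + lenOf cs j) (shOf cs j) (λ q → dem (π ++ (toℕ j ∷ q))) →
    Σ (List Dem) λ tours →
      AllTours S tours ×
      (∀ q → IsVertex S q →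
        deliveredAt tours q ≡ restrictTo π (toℕ i) (toℕ j) dem q) ×
      (totalCost S tours ≤
        four/three * (LB S dem - LB S (removeFrom π (toℕ i) (toℕ j) dem)))
lemma5 S dem hS hdem π cs h at i j i≢j p p' chain-i chain-j =
  resolve-pair S dem hS π cs h at i j i≢j
    (long-chain p _ (shOf cs i) _ (branch-nonNeg i) (λ q → hdem _) chain-i)
    (long-chain p' _ (shOf cs j) _ (branch-nonNeg j) (λ q → hdem _) chain-j)
  where
  branch-nonNeg : ∀ k → NonNegLen (shOf cs k)
  branch-nonNeg k = proj₂ (NonNegLen-child cs (At-NonNegLen at hS) k)
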